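{- Let $\mathcal{G}$ be any class of graphs and let $\overline{L(\mathcal{G})}$ denote the class of all graphs $\overline{L(G)}$ with $G\in\mathcal{G}$. Then the following statements are equivalent. (1) The class $\overline{L(\mathcal{G})}$ is $(\mathrm{tw},\omega)$-bounded. (2) The class $\overline{L(\mathcal{G})}$ has bounded tree-independence number. (3) There exists a positive integer $s$ such that every graph in $\overline{L(\mathcal{G})}$ is $K_{s,s}$-free. (4) There exists a positive integer $s$ such that every graph in $\overline{L(\mathcal{G})}$ has a vertex cover inducing a subgraph with independence number at most $s$. (5) There exists a positive integer $s$ such that every graph in $\mathcal{G}$ is $2K_{1,s}$-subgraph-free.
   Context: All graphs are finite, simple and undirected. $L(G)$ is the line graph of $G$ and $\overline{H}$ denotes the complement of $H$. A graph is $H$-free if it has no induced subgraph isomorphic to $H$, and $H$-subgraph-free if it has no (not necessarily induced) subgraph isomorphic to $H$. $2K_{1,s}$ is the disjoint union of two copies of the star $K_{1,s}$. A vertex cover is a set of vertices containing at least one endpoint of every edge. A tree decomposition of $G$ is a pair $(T,\{X_t\}_{t\in V(T)})$ with $T$ a tree and bags $X_t\subseteq V(G)$ such that every vertex lies in some bag, every edge has both endpoints in some bag, and for each vertex $v$ the nodes whose bags contain $v$ induce a connected subtree. Its independence number is $\max_t \alpha(G[X_t])$; the tree-independence number $\mathsf{tree}\text{ - }\alpha(G)$ is the minimum independence number over all tree decompositions of $G$; $\mathrm{tw}(G)$ is the treewidth and $\omega(G)$ the clique number. A graph class $\mathcal{C}$ is $(\mathrm{tw},\omega)$-bounded if there is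 a function $f:\mathbb{N}\to\mathbb{N}$ such that for every $G\in\mathcal{C}$ and every induced subgraph $G'$ of $G$, $\mathrm{tw}(G')\le f(\omega(G'))$. A class has bounded tree-independence number if there is a constant bounding $\mathsf{tree}\text{ - }\alpha$ of all its members. -}

module Defs where

open import Data.Nat using (ℕ; zero; suc; _+_; _≤_; _≡ᵇ_)
open import Data.Bool using (Bool; true; false; _∧_; _∨_; not; _xor_)
open import Data.Bool.Properties using (∧-comm)
open import Data.Fin using (Fin; toℕ; splitAt; _<?_)
import Data.Fin as F
open import Data.Fin.Subset using (Subset; _∈_; _⊆_; ∣_∣)
open import Data.List using (List; length; lookup; filter; concatMap; map; allFin)
open import Data.Product using (Σ; _×_; _,_; proj₁; proj₂; ∃)
open import Data.Sum using (_⊎_; inj₁; inj₂)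
open import Relation.Nullary using (¬_; ⌊_⌋; yes; no)
open import Relation.Nullary.Decidable using (_×-dec_)
open import Relation.Binary.PropositionalEquality using (_≡_; _≢_; refl; cong; cong₂; sym)
open import Function.Definitions using (Injective)

record Graph : Set where
  field
    n      : ℕ
    adj    : Fin n → Fin n → Bool
    adj-sym    : ∀ i j → adj i j ≡ adj j i
    adj-irrefl : ∀ i → adj i i ≡ false
open Graph public

_==_ : ∀ {n} → Fin n → Fin n → Bool
i == j = ⌊ i F.≟ j ⌋

==-sym : ∀ {n} (i j : Fin n) → (i == j) ≡ (j == i)
==-sym i j with i F.≟ j | j F.≟ i
... | yes _ | yes _ = refl
... | no _  | no _  = refl
... | yes p | no q  with q (sym p)
... | ()
==-sym i j | no q | yes p with q (sym p)
... | ()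

==-refl : ∀ {n} (i : Fin n) → (i == i) ≡ true
==-refl i with i F.≟ i
... | yes _ = refl
... | no q with q refl
... | ()

complement : Graph → Graph
complement G = record
  { n = n G
  ; adj = λ i j → not (i == j) ∧ not (adj G i j)
  ; adj-sym = λ i j → cong₂ (λ a b → not a ∧ not b) (==-sym i j) (adj-sym G i j)
  ; adj-irrefl = λ i → cong (λ a → not a ∧ not (adj G i i)) (==-refl i)
  }

-- Line graph: vertices are the edges {i,j} (listed as pairs with i < j),
-- two distinct edges adjacent iff they share an endpoint.

Edge : ℕ → Set
Edge n = Fin n × Fin n

edgeList : (G : Graph) → List (Edge (n G))
edgeList G = filter (λ p → (proj₁ p <? proj₂ p) ×-dec (adj G (proj₁ p) (proj₂ p) Data.Bool.≟ true))
                    (concatMap (λ i → map (i ,_) (allFin (n G))) (allFin (n G)))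
  where import Data.Bool

share : ∀ {n} → Edge n → Edge n → Bool
share (x , y) (x' , y') = (x == x') ∨ (x == y') ∨ (y == x') ∨ (y == y')

private
  swap-mid : ∀ a b c d → (a ∨ b ∨ c ∨ d) ≡ (a ∨ c ∨ b ∨ d)
  swap-mid false false c d = refl
  swap-mid false true false d = refl
  swap-mid false true true d = refl
  swap-mid true b c d = refl

share-sym : ∀ {n} (e f : Edge n) → share e f ≡ share f e
share-sym (x , y) (x' , y')
  rewrite ==-sym x x' | ==-sym x y' | ==-sym y x' | ==-sym y y'
  = swap-mid (x' == x) (y' == x) (x' == y) (y' == y)

lineGraph : Graph → Graph
lineGraph G = record
  { n = length es
  ; adj = λ a b → not (a == b) ∧ share (lookup es a) (lookup es b)
  ; adj-sym = λ a b → cong₂ (λ u v → not u ∧ v) (==-sym a b) (share-sym (lookup es a) (lookup es b))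
  ; adj-irrefl = λ a → cong (λ u → not u ∧ share (lookup es a) (lookup es a)) (==-refl a)
  }
  where es = edgeList G

coLine : Graph → Graph
coLine G = complement (lineGraph G)

InducedCopy : ∀ {m k} → (Fin m → Fin m → Bool) → (Fin k → Fin k → Bool) → Set
InducedCopy {m} {k} A B =
  Σ (Fin m → Fin k) λ f → Injective _≡_ _≡_ f × (∀ i j → B (f i) (f j) ≡ A i j)

SubgraphCopy : ∀ {m k} → (Fin m → Fin m → Bool) → (Fin k → Fin k → Bool) → Set
SubgraphCopy {m} {k} A B =
  Σ (Fin m → Fin k) λ f → Injective _≡_ _≡_ f × (∀ i j → A i j ≡ true → B (f i) (f j) ≡ true)

IsInducedSubgraphOf : Graph → Graph → Set
IsInducedSubgraphOf H G = InducedCopy (adj H) (adj G)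

-- K_{s,s} on Fin (s + s): first s vertices one side, last s the other
side : ∀ s {t} → Fin (s + t) → Bool
side s i with splitAt s i
... | inj₁ _ = true
... | inj₂ _ = false

Kss : (s : ℕ) → Fin (s + s) → Fin (s + s) → Bool
Kss s i j = side s i xor side s j

-- star K_{1,s} on Fin (suc s), centre = zero
star : (s : ℕ) → Fin (suc s) → Fin (suc s) → Bool
star s a b = (toℕ a ≡ᵇ 0) xor (toℕ b ≡ᵇ 0)

twoStars : (s : ℕ) → Fin (suc s + suc s) → Fin (suc s + suc s) → Bool
twoStars s i j with splitAt (suc s) i | splitAt (suc s) j
... | inj₁ a | inj₁ b = star s a b
... | inj₂ a | inj₂ b = star s a b
... | _      | _      = false

-- cycle C_k on Fin k (used for k ≥ 3)
cycleAdj : (k : ℕ) → Fin k → Fin k → Bool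
cycleAdj k i j =
  (suc (toℕ i) ≡ᵇ toℕ j) ∨ (suc (toℕ j) ≡ᵇ toℕ i)
  ∨ ((toℕ i ≡ᵇ 0) ∧ (suc (toℕ j) ≡ᵇ k)) ∨ ((toℕ j ≡ᵇ 0) ∧ (suc (toℕ i) ≡ᵇ k))

KssFree : Graph → ℕ → Set
KssFree G s = ¬ InducedCopy (Kss s) (adj G)

TwoStarSubgraphFree : Graph → ℕ → Set
TwoStarSubgraphFree G s = ¬ SubgraphCopy (twoStars s) (adj G)

data Walk {n} (A : Fin n → Fin n → Bool) (S : Fin n → Set) : Fin n → Fin n → Set where
  here : ∀ {u} → S u → Walk A S u u
  step : ∀ {u w v} → S u → A u w ≡ true → Walk A S w v → Walk A S u v

InducesConnected : (G : Graph) → (Fin (n G) → Set) → Set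
InducesConnected G S = ∀ u v → S u → S v → Walk (adj G) S u v

Connected : Graph → Set
Connected G = InducesConnected G (λ _ → Data.Unit.⊤)
  where import Data.Unit

Acyclic : Graph → Set
Acyclic G = ∀ k → 3 ≤ k → ¬ SubgraphCopy (cycleAdj k) (adj G)

IsTree : Graph → Set
IsTree T = 1 ≤ n T × Connected T × Acyclic T

record TreeDecomposition (G : Graph) : Set where
  field
    tree    : Graph
    isTree  : IsTree tree
    bag     : Fin (n tree) → Subset (n G)
    covers-vertices : ∀ v → ∃ λ t → v ∈ bag t
    covers-edges    : ∀ u v → adj G u v ≡ true → ∃ λ t → u ∈ bag t × v ∈ bag t
    connected-occ   : ∀ v → InducesConnected tree (λ t → v ∈ bag t)
open TreeDecomposition public

Independent : (G : Graph) → Subset (n G) → Set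
Independent G I = ∀ u v → u ∈ I → v ∈ I → adj G u v ≡ false

IsClique : (G : Graph) → Subset (n G) → Set
IsClique G C = ∀ u v → u ∈ C → v ∈ C → u ≢ v → adj G u v ≡ true

AlphaAtMost : (G : Graph) → Subset (n G) → ℕ → Set
AlphaAtMost G X k = ∀ I → I ⊆ X → Independent G I → ∣ I ∣ ≤ k

IsCliqueNumber : Graph → ℕ → Set
IsCliqueNumber G w =
  (Σ (Subset (n G)) λ C → IsClique G C × ∣ C ∣ ≡ w)
  × (∀ C → IsClique G C → ∣ C ∣ ≤ w)

TreewidthAtMost : Graph → ℕ → Set
TreewidthAtMost G k = Σ (TreeDecomposition G) λ D → ∀ t → ∣ bag D t ∣ ≤ suc k

TreeAlphaAtMost : Graph → ℕ → Set
TreeAlphaAtMost G k = Σ (TreeDecomposition G) λ D → ∀ t → AlphaAtMost G (bag D t) k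

IsVertexCover : (G : Graph) → Subset (n G) → Set
IsVertexCover G C = ∀ u v → adj G u v ≡ true → u ∈ C ⊎ v ∈ C

Class : Set₁
Class = Graph → Set

P1 : Class → Set
P1 𝒢 = Σ (ℕ → ℕ) λ f → ∀ G → 𝒢 G → ∀ H → IsInducedSubgraphOf H (coLine G)
        → ∀ w → IsCliqueNumber H w → TreewidthAtMost H (f w)

P2 : Class → Set
P2 𝒢 = Σ ℕ λ c → ∀ G → 𝒢 G → TreeAlphaAtMost (coLine G) c

P3 : Class → Set
P3 𝒢 = Σ ℕ λ s → 1 ≤ s × (∀ G → 𝒢 G → KssFree (coLine G) s)

P4 : Class → Set
P4 𝒢 = Σ ℕ λ s → 1 ≤ s × (∀ G → 𝒢 G →
          Σ (Subset (n (coLine G))) λ C → IsVertexCover (coLine G) C × AlphaAtMost (coLine G) C s)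

P5 : Class → Set
P5 𝒢 = Σ ℕ λ s → 1 ≤ s × (∀ G → 𝒢 G → TwoStarSubgraphFree G s)

-- Everything is routed through condition (5). Two disjoint stars K_{1,s} in G give 2s edges
-- inducing K_{s,s} in the complement of L(G); conversely, in a copy of K_{s+4,s+4} each side is
-- a set of more than three pairwise intersecting edges, hence a star, and the two stars are
-- disjoint. K_{s,s} has clique number 2, yet by the Helly property of subtrees one of its sides
-- lies in a single bag of any tree decomposition, forcing width and tree-independence number to
-- grow with s. If G has no 2K_{1,s}, at most one vertex h has degree above 2s; the edges missing h
-- form a vertex cover of the complement of L(G) whose independent sets, being pairwise
-- intersecting edge sets, have at most 2s + 3 elements. A vertex cover C with α(C) ≤ s gives the
-- star-shaped tree decomposition with bags C and C ∪ {v}, whose independence number is at most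
-- s + 1 and, by Ramsey's theorem, whose size is bounded in terms of the clique number.

module Submission where

open import Defs
open import Data.Bool using (Bool; true; false; not; _∧_; _∨_; _xor_; T)
import Data.Bool.Properties as Bool
open import Data.Fin using (Fin; zero; suc; toℕ; inject≤; punchIn; punchOut; _↑ˡ_; _↑ʳ_; splitAt)
import Data.Fin as Fin
open import Data.Fin.Properties
  using ( _≟_; any?; _<?_; <-cmp; <⇒≢; <-asym; 0≢1+n; suc-injective; injective⇒≤
        ; toℕ<n; toℕ-inject≤; toℕ-injective; inject≤-injective; punchIn-injective; punchIn-punchOut; punchInᵢ≢i
        ; splitAt-↑ˡ; splitAt-↑ʳ; splitAt⁻¹-↑ˡ; splitAt⁻¹-↑ʳ; ↑ˡ-injective; ↑ʳ-injective)
open import Data.Fin.Subset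
  using (Subset; _∈_; _∉_; _⊆_; ∣_∣; ⊥; ⊤; ⁅_⁆; _∪_; _∩_; _─_; _-_; Nonempty; inside; outside)
open import Data.Fin.Subset.Properties
  using ( _∈?_; ∈⊤; ∉⊥; x∈⁅x⁆; x∈⁅y⁆⇒x≡y; ∣⁅x⁆∣≡1; ∣⊥∣≡0; ∣⊤∣≡n; x∈p∪q⁺; x∈p∪q⁻; x∈p∩q⁻; p∩q⊆p; ∣p∩q∣≤∣q∣
        ; p─q⊆p; x∈p∧x≢y⇒x∈p-y; x∈p⇒∣p-x∣<∣p∣; p⊆q⇒∣p∣≤∣q∣; nonempty?; Empty-unique)
open import Data.List using (List; []; _∷_; _++_; lookup; concatMap; map; allFin; cartesianProduct)
import Data.List.Membership.Propositional as List
open import Data.List.Membership.Propositional.Properties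
  using (∈-lookup; ∈-filter⁻; ∈-filter⁺; ∈-allFin; ∈-cartesianProduct⁺)
import Data.List.Relation.Unary.All as All
open import Data.List.Relation.Unary.AllPairs using ([]; _∷_)
open import Data.List.Relation.Unary.Any using (index)
open import Data.List.Relation.Unary.Any.Properties using (lookup-index)
open import Data.List.Relation.Unary.Unique.Propositional using (Unique)
open import Data.List.Relation.Unary.Unique.Propositional.Properties using (filter⁺; cartesianProduct⁺; allFin⁺)
open import Data.Nat using (ℕ; zero; suc; _+_; _≤_; _<_; z≤n; s≤s; _≤?_; _≡ᵇ_)
open import Data.Nat.Properties
  using ( ≤-trans; ≤-reflexive; ≤-antisym; ≤-pred; <⇒≤; ≰⇒>; <-irrefl; n≤1+n; m≤m+n; m≤n+m; n≢0⇒n>0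
        ; +-suc; +-comm; +-monoˡ-≤; +-monoʳ-≤; +-cancelˡ-≤; ≡ᵇ⇒≡; module ≤-Reasoning)
import Data.Nat.Properties as ℕ
open import Data.Product using (Σ; _×_; _,_; proj₁; proj₂; ∃; map₂; swap)
open import Data.Sum using (_⊎_; inj₁; inj₂; [_,_]′)
open import Data.Unit using (tt)
import Data.Unit as Unit
open import Data.Vec using ([]; _∷_; here; there; tabulate)
open import Data.Vec.Properties using ([]=⇒lookup; lookup⇒[]=; lookup∘tabulate)
open import Function using (id; _∘_; _∘′_)
open import Function.Bundles using (_⇔_; mk⇔)
open import Function.Definitions using (Injective)
open import Level using (Level)
open import Relation.Binary using (tri<; tri≈; tri>)
open import Relation.Binary.PropositionalEquality using (_≡_; _≢_; refl; sym; trans; cong; cong₂; subst; subst₂)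
open import Relation.Nullary using (¬_; Dec; yes; no; does; contradiction)
open import Relation.Nullary.Decidable using (_×-dec_; ¬?; decidable-stable; dec-true)
open import Relation.Unary using (Pred; Decidable)

private
  variable
    ℓ : Level
    k m N : ℕ

∨-true⁻ : ∀ a b → (a ∨ b) ≡ true → a ≡ true ⊎ b ≡ true
∨-true⁻ true b _ = inj₁ refl
∨-true⁻ false b h = inj₂ h

∧-true⁻ : ∀ a b → (a ∧ b) ≡ true → a ≡ true × b ≡ true
∧-true⁻ true true _ = refl , refl

≡ᵇ-true⁻ : ∀ m n → (m ≡ᵇ n) ≡ true → m ≡ n
≡ᵇ-true⁻ m n e = ≡ᵇ⇒≡ m n (subst T (sym e) tt)

==⇒≡ : ∀ {m} {i j : Fin m} → (i == j) ≡ true → i ≡ j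
==⇒≡ {i = i} {j} h with i ≟ j
... | yes i≡j = i≡j

∨-trueˡ : ∀ {a} b → a ≡ true → (a ∨ b) ≡ true
∨-trueˡ b refl = refl

∨-trueʳ : ∀ a {b} → b ≡ true → (a ∨ b) ≡ true
∨-trueʳ a refl = Bool.∨-zeroʳ a

subset : {P : Pred (Fin N) ℓ} → Decidable P → Subset N
subset P? = tabulate (does ∘ P?)

module _ {P : Pred (Fin N) ℓ} (P? : Decidable P) where

  ∈-subset⁺ : ∀ {x} → P x → x ∈ subset P?
  ∈-subset⁺ {x} px = lookup⇒[]= x (subset P?) (trans (lookup∘tabulate _ x) (dec-true (P? x) px))

  ∈-subset⁻ : ∀ {x} → x ∈ subset P? → P x
  ∈-subset⁻ {x} x∈ with P? x | trans (sym (lookup∘tabulate (does ∘ P?) x)) ([]=⇒lookup x∈)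
  ... | yes px | _ = px

injectiveOn⇒∣p∣≤∣q∣ : (f : Fin m → Fin N) {p : Subset m} {q : Subset N} →
                      (∀ {x} → x ∈ p → f x ∈ q) →
                      (∀ {x y} → x ∈ p → y ∈ p → f x ≡ f y → x ≡ y) → ∣ p ∣ ≤ ∣ q ∣
injectiveOn⇒∣p∣≤∣q∣ f {[]} into inj = z≤n
injectiveOn⇒∣p∣≤∣q∣ f {outside ∷ p} into inj =
  injectiveOn⇒∣p∣≤∣q∣ (f ∘ suc) (into ∘ there) (λ x∈ y∈ e → suc-injective (inj (there x∈) (there y∈) e))
injectiveOn⇒∣p∣≤∣q∣ f {inside ∷ p} {q} into inj =
  ≤-trans (s≤s (injectiveOn⇒∣p∣≤∣q∣ (f ∘ suc) into′ inj′)) (x∈p⇒∣p-x∣<∣p∣ (into here))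
  where
  into′ : ∀ {x} → x ∈ p → f (suc x) ∈ q - f zero
  into′ x∈ = x∈p∧x≢y⇒x∈p-y (into (there x∈)) (λ e → 0≢1+n (sym (inj (there x∈) here e)))
  inj′ : ∀ {x y} → x ∈ p → y ∈ p → f (suc x) ≡ f (suc y) → x ≡ y
  inj′ x∈ y∈ e = suc-injective (inj (there x∈) (there y∈) e)

injective⇒≤∣q∣ : (f : Fin m → Fin N) {q : Subset N} → Injective _≡_ _≡_ f → (∀ x → f x ∈ q) → m ≤ ∣ q ∣
injective⇒≤∣q∣ {m} f f-inj into =
  subst (_≤ _) (∣⊤∣≡n m) (injectiveOn⇒∣p∣≤∣q∣ f {p = ⊤} (λ {x} _ → into x) (λ _ _ → f-inj))

x∈p─q⇒x∉q : (p q : Subset N) {x : Fin N} → x ∈ p ─ q → x ∉ q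
x∈p─q⇒x∉q (inside ∷ p) (outside ∷ q) here ()
x∈p─q⇒x∉q (_ ∷ p) (_ ∷ q) (there x∈) (there x∈q) = x∈p─q⇒x∉q p q x∈ x∈q

∣p∣≤∣p∩q∣+∣p─q∣ : (p q : Subset N) → ∣ p ∣ ≤ ∣ p ∩ q ∣ + ∣ p ─ q ∣
∣p∣≤∣p∩q∣+∣p─q∣ [] [] = z≤n
∣p∣≤∣p∩q∣+∣p─q∣ (outside ∷ p) (outside ∷ q) = ∣p∣≤∣p∩q∣+∣p─q∣ p q
∣p∣≤∣p∩q∣+∣p─q∣ (outside ∷ p) (inside ∷ q) = ∣p∣≤∣p∩q∣+∣p─q∣ p q
∣p∣≤∣p∩q∣+∣p─q∣ (inside ∷ p) (inside ∷ q) = s≤s (∣p∣≤∣p∩q∣+∣p─q∣ p q)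
∣p∣≤∣p∩q∣+∣p─q∣ (inside ∷ p) (outside ∷ q) =
  subst (suc ∣ p ∣ ≤_) (sym (+-suc ∣ p ∩ q ∣ ∣ p ─ q ∣)) (s≤s (∣p∣≤∣p∩q∣+∣p─q∣ p q))

∣p∣≤∣p─q∣+∣q∣ : (p q : Subset N) → ∣ p ∣ ≤ ∣ p ─ q ∣ + ∣ q ∣
∣p∣≤∣p─q∣+∣q∣ p q = begin
  ∣ p ∣                     ≤⟨ ∣p∣≤∣p∩q∣+∣p─q∣ p q ⟩
  ∣ p ∩ q ∣ + ∣ p ─ q ∣     ≤⟨ +-monoˡ-≤ ∣ p ─ q ∣ (∣p∩q∣≤∣q∣ p q) ⟩
  ∣ q ∣ + ∣ p ─ q ∣         ≡⟨ +-comm ∣ q ∣ ∣ p ─ q ∣ ⟩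
  ∣ p ─ q ∣ + ∣ q ∣         ∎
  where open ≤-Reasoning

∣p∣≤1+∣p-x∣ : (p : Subset N) (x : Fin N) → ∣ p ∣ ≤ suc ∣ p - x ∣
∣p∣≤1+∣p-x∣ p x = begin
  ∣ p ∣                     ≤⟨ ∣p∣≤∣p─q∣+∣q∣ p ⁅ x ⁆ ⟩
  ∣ p - x ∣ + ∣ ⁅ x ⁆ ∣     ≡⟨ cong (∣ p - x ∣ +_) (∣⁅x⁆∣≡1 x) ⟩
  ∣ p - x ∣ + 1             ≡⟨ +-comm ∣ p - x ∣ 1 ⟩
  suc ∣ p - x ∣             ∎
  where open ≤-Reasoning

x∈p-y⇒x≢y : (p : Subset N) {x y : Fin N} → x ∈ p - y → x ≢ y
x∈p-y⇒x≢y p {y = y} x∈ refl = x∈p─q⇒x∉q p ⁅ y ⁆ x∈ (x∈⁅x⁆ y)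

[p∪⁅x⁆]-x⊆p : (p : Subset N) (x : Fin N) → (p ∪ ⁅ x ⁆) - x ⊆ p
[p∪⁅x⁆]-x⊆p p x {y} y∈ with x∈p∪q⁻ p ⁅ x ⁆ (p─q⊆p _ ⁅ x ⁆ y∈)
... | inj₁ y∈p = y∈p
... | inj₂ y∈x = contradiction (x∈⁅y⁆⇒x≡y x y∈x) (x∈p-y⇒x≢y (p ∪ ⁅ x ⁆) y∈)

∣p∪⁅x⁆∣≤1+∣p∣ : (p : Subset N) (x : Fin N) → ∣ p ∪ ⁅ x ⁆ ∣ ≤ suc ∣ p ∣
∣p∪⁅x⁆∣≤1+∣p∣ p x = ≤-trans (∣p∣≤1+∣p-x∣ (p ∪ ⁅ x ⁆) x) (s≤s (p⊆q⇒∣p∣≤∣q∣ ([p∪⁅x⁆]-x⊆p p x)))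

x∉p⇒∣p∣<∣p∪⁅x⁆∣ : (p : Subset N) {x : Fin N} → x ∉ p → ∣ p ∣ < ∣ p ∪ ⁅ x ⁆ ∣
x∉p⇒∣p∣<∣p∪⁅x⁆∣ p {x} x∉p =
  ≤-trans (s≤s (p⊆q⇒∣p∣≤∣q∣ p⊆)) (x∈p⇒∣p-x∣<∣p∣ {p = p ∪ ⁅ x ⁆} (x∈p∪q⁺ (inj₂ (x∈⁅x⁆ x))))
  where
  p⊆ : p ⊆ (p ∪ ⁅ x ⁆) - x
  p⊆ y∈ = x∈p∧x≢y⇒x∈p-y (x∈p∪q⁺ (inj₁ y∈)) (λ { refl → x∉p y∈ })

∣p∣>0⇒Nonempty : (p : Subset N) → 0 < ∣ p ∣ → Nonempty p
∣p∣>0⇒Nonempty {N} p 0<∣p∣ with nonempty? p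
... | yes ne = ne
... | no empty = contradiction (subst (λ q → 0 < ∣ q ∣) (Empty-unique empty) 0<∣p∣) ⊥-has-no-elements
  where
  ⊥-has-no-elements : ¬ (0 < ∣ ⊥ {N} ∣)
  ⊥-has-no-elements 0<∣⊥∣ = <-irrefl refl (subst (0 <_) (∣⊥∣≡0 N) 0<∣⊥∣)

starVertex : ∀ {A : Set} {s} → A → (Fin s → A) → Fin (suc s) → A
starVertex c l zero = c
starVertex c l (suc k) = l k

starVertex-injective : ∀ {A : Set} {s} {c : A} {l : Fin s → A} → Injective _≡_ _≡_ l → (∀ k → l k ≢ c) →
                       Injective _≡_ _≡_ (starVertex c l)
starVertex-injective l-inj l≢c {zero} {zero} _ = refl
starVertex-injective l-inj l≢c {zero} {suc b} e = contradiction (sym e) (l≢c b)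
starVertex-injective l-inj l≢c {suc a} {zero} e = contradiction e (l≢c a)
starVertex-injective l-inj l≢c {suc a} {suc b} e = cong suc (l-inj e)

DistinctElements : ℕ → Subset N → Set
DistinctElements {N} k p = Σ (Fin k → Fin N) λ g → Injective _≡_ _≡_ g × (∀ i → g i ∈ p)

distinctElements : (p : Subset N) → k ≤ ∣ p ∣ → DistinctElements k p
distinctElements {k = zero} p _ = (λ ()) , (λ { {()} }) , λ ()
distinctElements {k = suc k} p k<∣p∣ with ∣p∣>0⇒Nonempty p (≤-trans (s≤s z≤n) k<∣p∣)
... | x , x∈p with distinctElements (p - x) (≤-pred (≤-trans k<∣p∣ (∣p∣≤1+∣p-x∣ p x)))
... | g , g-inj , g∈ = starVertex x g , starVertex-injective g-inj (λ i → x∈p-y⇒x≢y p (g∈ i)) , ∈p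
  where
  ∈p : ∀ i → starVertex x g i ∈ p
  ∈p zero = x∈p
  ∈p (suc i) = p─q⊆p p ⁅ x ⁆ (g∈ i)

image : (Fin k → Fin N) → Subset N
image {zero} f = ⊥
image {suc k} f = image (f ∘ suc) ∪ ⁅ f zero ⁆

∈-image : (f : Fin k → Fin N) (i : Fin k) → f i ∈ image f
∈-image f zero = x∈p∪q⁺ (inj₂ (x∈⁅x⁆ (f zero)))
∈-image f (suc i) = x∈p∪q⁺ (inj₁ (∈-image (f ∘ suc) i))

∣image∣≤k : (f : Fin k → Fin N) → ∣ image f ∣ ≤ k
∣image∣≤k {zero} {N} f = ≤-reflexive (∣⊥∣≡0 N)
∣image∣≤k {suc k} f = ≤-trans (∣p∪⁅x⁆∣≤1+∣p∣ (image (f ∘ suc)) (f zero)) (s≤s (∣image∣≤k (f ∘ suc)))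

k+m≤∣p∣⇒m≤∣p─image∣ : ∀ {m} (f : Fin k → Fin N) (p : Subset N) → k + m ≤ ∣ p ∣ → m ≤ ∣ p ─ image f ∣
k+m≤∣p∣⇒m≤∣p─image∣ {k} {m = m} f p k+m≤∣p∣ = +-cancelˡ-≤ k m ∣ p ─ image f ∣ (begin
  k + m                          ≤⟨ k+m≤∣p∣ ⟩
  ∣ p ∣                          ≤⟨ ∣p∣≤∣p─q∣+∣q∣ p (image f) ⟩
  ∣ p ─ image f ∣ + ∣ image f ∣  ≤⟨ +-monoʳ-≤ ∣ p ─ image f ∣ (∣image∣≤k f) ⟩
  ∣ p ─ image f ∣ + k            ≡⟨ +-comm ∣ p ─ image f ∣ k ⟩
  k + ∣ p ─ image f ∣            ∎)
  where open ≤-Reasoning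

triple : Fin N → Fin N → Fin N → Subset N
triple x y z = (⁅ x ⁆ ∪ ⁅ y ⁆) ∪ ⁅ z ⁆

∈-triple : (x y z : Fin N) {a : Fin N} → a ≡ x ⊎ a ≡ y ⊎ a ≡ z → a ∈ triple x y z
∈-triple x y z (inj₁ refl) = x∈p∪q⁺ (inj₁ (x∈p∪q⁺ (inj₁ (x∈⁅x⁆ x))))
∈-triple x y z (inj₂ (inj₁ refl)) = x∈p∪q⁺ (inj₁ (x∈p∪q⁺ (inj₂ (x∈⁅x⁆ y))))
∈-triple x y z (inj₂ (inj₂ refl)) = x∈p∪q⁺ (inj₂ (x∈⁅x⁆ z))

∣triple∣≤3 : (x y z : Fin N) → ∣ triple x y z ∣ ≤ 3
∣triple∣≤3 x y z =
  ≤-trans (∣p∪⁅x⁆∣≤1+∣p∣ (⁅ x ⁆ ∪ ⁅ y ⁆) z) (s≤s (≤-trans (∣p∪⁅x⁆∣≤1+∣p∣ ⁅ x ⁆ y) (s≤s (≤-reflexive (∣⁅x⁆∣≡1 x)))))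

module _ {p S : Subset N} {x : Fin N} (S⊆p-x : S ⊆ p - x) where

  ⊆p-x⇒x∉ : x ∉ S
  ⊆p-x⇒x∉ x∈S = x∈p-y⇒x≢y p (S⊆p-x x∈S) refl

  ⊆p-x⇒∪⁅x⁆⊆p : x ∈ p → S ∪ ⁅ x ⁆ ⊆ p
  ⊆p-x⇒∪⁅x⁆⊆p x∈p y∈ with x∈p∪q⁻ S ⁅ x ⁆ y∈
  ... | inj₁ y∈S = p─q⊆p p ⁅ x ⁆ (S⊆p-x y∈S)
  ... | inj₂ y∈x rewrite x∈⁅y⁆⇒x≡y x y∈x = x∈p

-- Ramsey's theorem

neighbourhood : (X : Graph) → Fin (n X) → Subset (n X)
neighbourhood X v = subset (λ u → adj X v u Bool.≟ true)

module _ (X : Graph) {v : Fin (n X)} where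

  ∈-neighbourhood⁺ : ∀ {u} → adj X v u ≡ true → u ∈ neighbourhood X v
  ∈-neighbourhood⁺ = ∈-subset⁺ (λ u → adj X v u Bool.≟ true)

  ∈-neighbourhood⁻ : ∀ {u} → u ∈ neighbourhood X v → adj X v u ≡ true
  ∈-neighbourhood⁻ = ∈-subset⁻ (λ u → adj X v u Bool.≟ true)

  ∉-neighbourhood⇒non-adjacent : ∀ {u} → u ∉ neighbourhood X v → adj X v u ≡ false
  ∉-neighbourhood⇒non-adjacent {u} u∉ = Bool.¬-not (u∉ ∘′ ∈-neighbourhood⁺)

  isClique-∪⁅v⁆ : ∀ {K} → IsClique X K → (∀ {x} → x ∈ K → adj X v x ≡ true) → IsClique X (K ∪ ⁅ v ⁆)
  isClique-∪⁅v⁆ {K} clique v~K x y x∈ y∈ x≢y with x∈p∪q⁻ K ⁅ v ⁆ x∈ | x∈p∪q⁻ K ⁅ v ⁆ y∈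
  ... | inj₁ x∈K | inj₁ y∈K = clique x y x∈K y∈K x≢y
  ... | inj₁ x∈K | inj₂ y≡v rewrite x∈⁅y⁆⇒x≡y v y≡v = trans (adj-sym X x v) (v~K x∈K)
  ... | inj₂ x≡v | inj₁ y∈K rewrite x∈⁅y⁆⇒x≡y v x≡v = v~K y∈K
  ... | inj₂ x≡v | inj₂ y≡v = contradiction (trans (x∈⁅y⁆⇒x≡y v x≡v) (sym (x∈⁅y⁆⇒x≡y v y≡v))) x≢y

  independent-∪⁅v⁆ : ∀ {I} → Independent X I → (∀ {x} → x ∈ I → adj X v x ≡ false) →
                     Independent X (I ∪ ⁅ v ⁆)
  independent-∪⁅v⁆ {I} indep v≁I x y x∈ y∈ with x∈p∪q⁻ I ⁅ v ⁆ x∈ | x∈p∪q⁻ I ⁅ v ⁆ y∈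
  ... | inj₁ x∈I | inj₁ y∈I = indep x y x∈I y∈I
  ... | inj₁ x∈I | inj₂ y≡v rewrite x∈⁅y⁆⇒x≡y v y≡v = trans (adj-sym X x v) (v≁I x∈I)
  ... | inj₂ x≡v | inj₁ y∈I rewrite x∈⁅y⁆⇒x≡y v x≡v = v≁I y∈I
  ... | inj₂ x≡v | inj₂ y≡v rewrite x∈⁅y⁆⇒x≡y v x≡v | x∈⁅y⁆⇒x≡y v y≡v = adj-irrefl X v

ramseyBound : ℕ → ℕ → ℕ
ramseyBound zero b = 0
ramseyBound (suc a) zero = 0
ramseyBound (suc a) (suc b) = suc (ramseyBound a (suc b) + ramseyBound (suc a) b)

HasCliqueIn : (X : Graph) → ℕ → Subset (n X) → Set
HasCliqueIn X a Y = Σ (Subset (n X)) λ K → K ⊆ Y × IsClique X K × a ≤ ∣ K ∣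

HasIndependentIn : (X : Graph) → ℕ → Subset (n X) → Set
HasIndependentIn X b Y = Σ (Subset (n X)) λ I → I ⊆ Y × Independent X I × b ≤ ∣ I ∣

ramsey : (X : Graph) (a b : ℕ) (Y : Subset (n X)) → ramseyBound a b ≤ ∣ Y ∣ →
         HasCliqueIn X a Y ⊎ HasIndependentIn X b Y
ramsey X zero b Y _ = inj₁ (⊥ , (λ x∈ → contradiction x∈ ∉⊥) , (λ _ _ x∈ → contradiction x∈ ∉⊥) , z≤n)
ramsey X (suc a) zero Y _ = inj₂ (⊥ , (λ x∈ → contradiction x∈ ∉⊥) , (λ _ _ x∈ → contradiction x∈ ∉⊥) , z≤n)
ramsey X (suc a) (suc b) Y bound with ∣p∣>0⇒Nonempty Y (≤-trans (s≤s z≤n) bound)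
... | v , v∈Y = split (ramseyBound a (suc b) ≤? ∣ (Y - v) ∩ Nv ∣)
  where
  Nv : Subset (n X)
  Nv = neighbourhood X v
  -- the at least R(a, b+1) + R(a+1, b) vertices of Y - v split into neighbours and non-neighbours of v
  split : Dec (ramseyBound a (suc b) ≤ ∣ (Y - v) ∩ Nv ∣) → HasCliqueIn X (suc a) Y ⊎ HasIndependentIn X (suc b) Y
  split (yes big∩) with ramsey X a (suc b) ((Y - v) ∩ Nv) big∩
  ... | inj₂ (I , I⊆ , indep , size) = inj₂ (I , p─q⊆p Y ⁅ v ⁆ ∘ p∩q⊆p _ Nv ∘ I⊆ , indep , size)
  ... | inj₁ (K , K⊆ , clique , size) =
    inj₁ (K ∪ ⁅ v ⁆ , ⊆p-x⇒∪⁅x⁆⊆p K⊆Y-v v∈Y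
         , isClique-∪⁅v⁆ X clique (λ x∈ → ∈-neighbourhood⁻ X (proj₂ (x∈p∩q⁻ _ Nv (K⊆ x∈))))
         , ≤-trans (s≤s size) (x∉p⇒∣p∣<∣p∪⁅x⁆∣ K (⊆p-x⇒x∉ K⊆Y-v)))
    where
    K⊆Y-v : K ⊆ Y - v
    K⊆Y-v = p∩q⊆p _ Nv ∘ K⊆
  split (no small∩) with ramsey X (suc a) b (Y - v ─ Nv) big─
    where
    big─ : ramseyBound (suc a) b ≤ ∣ Y - v ─ Nv ∣
    big─ = +-cancelˡ-≤ (ramseyBound a (suc b)) _ _ (≤-trans
             (≤-trans (≤-pred (≤-trans bound (∣p∣≤1+∣p-x∣ Y v))) (∣p∣≤∣p∩q∣+∣p─q∣ (Y - v) Nv))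
             (+-monoˡ-≤ _ (<⇒≤ (≰⇒> small∩))))
  ... | inj₁ (K , K⊆ , clique , size) = inj₁ (K , p─q⊆p Y ⁅ v ⁆ ∘ p─q⊆p _ Nv ∘ K⊆ , clique , size)
  ... | inj₂ (I , I⊆ , indep , size) =
    inj₂ (I ∪ ⁅ v ⁆ , ⊆p-x⇒∪⁅x⁆⊆p I⊆Y-v v∈Y
         , independent-∪⁅v⁆ X indep (λ x∈ → ∉-neighbourhood⇒non-adjacent X (x∈p─q⇒x∉q _ Nv (I⊆ x∈)))
         , ≤-trans (s≤s size) (x∉p⇒∣p∣<∣p∪⁅x⁆∣ I (⊆p-x⇒x∉ I⊆Y-v)))
    where
    I⊆Y-v : I ⊆ Y - v
    I⊆Y-v = p─q⊆p _ Nv ∘ I⊆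

-- Star-shaped tree decompositions

starGraph : ℕ → Graph
starGraph N = record
  { n = suc N
  ; adj = star N
  ; adj-sym = λ i j → Bool.xor-comm (toℕ i ≡ᵇ 0) (toℕ j ≡ᵇ 0)
  ; adj-irrefl = λ i → Bool.xor-same (toℕ i ≡ᵇ 0)
  }

star-connected : ∀ N → Connected (starGraph N)
star-connected N zero zero _ _ = here tt
star-connected N zero (suc v) _ _ = step tt refl (here tt)
star-connected N (suc u) zero _ _ = step tt refl (here tt)
star-connected N (suc u) (suc v) _ _ = step {w = zero} tt refl (step tt refl (here tt))

star-path-centre : {a b c : Fin (suc N)} → star N a b ≡ true → star N b c ≡ true → a ≢ c → b ≡ zero
star-path-centre {b = zero} _ _ _ = refl
star-path-centre {a = zero} {suc b} {zero} _ _ a≢c = contradiction refl a≢c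

cycle-successor-of-2 : ∀ k → Fin (3 + k)
cycle-successor-of-2 zero = zero
cycle-successor-of-2 (suc k) = suc (suc (suc zero))

cycleAdj-2-successor : ∀ k → cycleAdj (3 + k) (suc (suc zero)) (cycle-successor-of-2 k) ≡ true
cycleAdj-2-successor zero = refl
cycleAdj-2-successor (suc k) = refl

successor-of-2≢1 : ∀ k → cycle-successor-of-2 k ≢ suc zero
successor-of-2≢1 zero ()
successor-of-2≢1 (suc k) ()

star-acyclic : ∀ N → Acyclic (starGraph N)
star-acyclic N (suc zero) (s≤s ())
star-acyclic N (suc (suc zero)) (s≤s (s≤s ()))
-- f 1 and f 2 each lie on two cycle edges with distinct other ends, so both are the centre
star-acyclic N (suc (suc (suc k))) _ (f , f-inj , f-edge) = contradiction (f-inj (trans f₁≡0 (sym f₂≡0))) λ ()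
  where
  f₁≡0 : f (suc zero) ≡ zero
  f₁≡0 = star-path-centre (f-edge zero (suc zero) refl) (f-edge (suc zero) (suc (suc zero)) refl) (λ e → contradiction (f-inj e) λ ())
  f₂≡0 : f (suc (suc zero)) ≡ zero
  f₂≡0 = star-path-centre (f-edge (suc zero) (suc (suc zero)) refl) (f-edge _ _ (cycleAdj-2-successor k))
                          (successor-of-2≢1 k ∘ sym ∘ f-inj)

starBag : Subset N → Fin (suc N) → Subset N
starBag D zero = D
starBag D (suc v) = D ∪ ⁅ v ⁆

module _ (X : Graph) {D : Subset (n X)} where

  starDecomposition : IsVertexCover X D → TreeDecomposition X
  starDecomposition cover = record
    { tree = starGraph (n X)
    ; isTree = s≤s z≤n , star-connected (n X) , star-acyclic (n X)
    ; bag = starBag D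
    ; covers-vertices = λ v → suc v , x∈p∪q⁺ (inj₂ (x∈⁅x⁆ v))
    ; covers-edges = covers-edges′
    ; connected-occ = connected-occ′
    }
    where
    covers-edges′ : ∀ u v → adj X u v ≡ true → ∃ λ t → u ∈ starBag D t × v ∈ starBag D t
    covers-edges′ u v u~v with cover u v u~v
    ... | inj₁ u∈D = suc v , x∈p∪q⁺ (inj₁ u∈D) , x∈p∪q⁺ (inj₂ (x∈⁅x⁆ v))
    ... | inj₂ v∈D = suc u , x∈p∪q⁺ (inj₂ (x∈⁅x⁆ u)) , x∈p∪q⁺ (inj₁ v∈D)
    only-own-leaf : ∀ {v} t → v ∈ starBag D t → v ∉ D → t ≡ suc v
    only-own-leaf zero v∈ v∉D = contradiction v∈ v∉D
    only-own-leaf {v} (suc w) v∈ v∉D with x∈p∪q⁻ D ⁅ w ⁆ v∈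
    ... | inj₁ v∈D = contradiction v∈D v∉D
    ... | inj₂ v∈w = cong suc (sym (x∈⁅y⁆⇒x≡y w v∈w))
    in-every-bag : ∀ {v} → v ∈ D → ∀ t → v ∈ starBag D t
    in-every-bag v∈D zero = v∈D
    in-every-bag v∈D (suc w) = x∈p∪q⁺ (inj₁ v∈D)
    connected-occ′ : ∀ v → InducesConnected (starGraph (n X)) (λ t → v ∈ starBag D t)
    connected-occ′ v t t′ v∈t v∈t′ with v ∈? D
    ... | yes v∈D = walk t t′
      where
      walk : ∀ t t′ → Walk (star (n X)) (λ t → v ∈ starBag D t) t t′
      walk zero zero = here v∈D
      walk zero (suc w) = step v∈D refl (here (in-every-bag v∈D (suc w)))
      walk (suc u) zero = step (in-every-bag v∈D (suc u)) refl (here v∈D)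
      walk (suc u) (suc w) =
        step {w = zero} (in-every-bag v∈D (suc u)) refl (step v∈D refl (here (in-every-bag v∈D (suc w))))
    ... | no v∉D with only-own-leaf t v∈t v∉D | only-own-leaf t′ v∈t′ v∉D
    ...   | refl | refl = here v∈t

  ∣starBag∣≤1+∣D∣ : ∀ t → ∣ starBag D t ∣ ≤ suc ∣ D ∣
  ∣starBag∣≤1+∣D∣ zero = n≤1+n _
  ∣starBag∣≤1+∣D∣ (suc v) = ∣p∪⁅x⁆∣≤1+∣p∣ D v

  starBag-alphaAtMost : ∀ {s} → AlphaAtMost X D s → ∀ t → AlphaAtMost X (starBag D t) (suc s)
  starBag-alphaAtMost α≤s zero I I⊆ indep = ≤-trans (α≤s I I⊆ indep) (n≤1+n _)
  starBag-alphaAtMost α≤s (suc v) I I⊆ indep =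
    ≤-trans (∣p∣≤1+∣p-x∣ I v) (s≤s (α≤s (I - v) I-v⊆D (λ x y x∈ y∈ → indep x y (p─q⊆p I ⁅ v ⁆ x∈) (p─q⊆p I ⁅ v ⁆ y∈))))
    where
    I-v⊆D : I - v ⊆ D
    I-v⊆D x∈ with x∈p∪q⁻ D ⁅ v ⁆ (I⊆ (p─q⊆p I ⁅ v ⁆ x∈))
    ... | inj₁ x∈D = x∈D
    ... | inj₂ x∈v = contradiction (x∈⁅y⁆⇒x≡y v x∈v) (x∈p-y⇒x≢y I x∈)

  vertexCover⇒treeAlphaAtMost : ∀ {s} → IsVertexCover X D → AlphaAtMost X D s → TreeAlphaAtMost X (suc s)
  vertexCover⇒treeAlphaAtMost cover α≤s = starDecomposition cover , starBag-alphaAtMost α≤s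

  vertexCover⇒treewidthAtMost : ∀ {k} → IsVertexCover X D → ∣ D ∣ ≤ k → TreewidthAtMost X k
  vertexCover⇒treewidthAtMost cover ∣D∣≤k = starDecomposition cover , λ t → ≤-trans (∣starBag∣≤1+∣D∣ t) (s≤s ∣D∣≤k)

module _ (Z : Graph) {X : Subset (n Z)} {c : ℕ} (α≤c : AlphaAtMost Z X c) where

  nonAdjacentCopy⇒∣p∣≤α : (f : Fin m → Fin (n Z)) {I : Subset m} →
                          (∀ {x} → x ∈ I → f x ∈ X) →
                          (∀ {x y} → x ∈ I → y ∈ I → f x ≡ f y → x ≡ y) →
                          (∀ {x y} → x ∈ I → y ∈ I → adj Z (f x) (f y) ≡ false) → ∣ I ∣ ≤ c
  nonAdjacentCopy⇒∣p∣≤α f {I} into inj non-adj =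
    ≤-trans (injectiveOn⇒∣p∣≤∣q∣ f (λ {x} x∈ → ∈-subset⁺ inImage? (x , x∈ , refl)) inj) (α≤c J J⊆X J-indep)
    where
    inImage? : Decidable (λ z → ∃ λ x → x ∈ I × f x ≡ z)
    inImage? z = any? (λ x → (x ∈? I) ×-dec (f x ≟ z))
    J : Subset (n Z)
    J = subset inImage?
    J⊆X : J ⊆ X
    J⊆X z∈ with ∈-subset⁻ inImage? z∈
    ... | x , x∈ , refl = into x∈
    J-indep : Independent Z J
    J-indep z z′ z∈ z′∈ with ∈-subset⁻ inImage? z∈ | ∈-subset⁻ inImage? z′∈
    ... | x , x∈ , refl | x′ , x′∈ , refl = non-adj x∈ x′∈

  nonAdjacentFamily⇒≤α : (f : Fin m → Fin (n Z)) → Injective _≡_ _≡_ f → (∀ i → f i ∈ X) →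
                         (∀ i j → adj Z (f i) (f j) ≡ false) → m ≤ c
  nonAdjacentFamily⇒≤α {m} f f-inj into non-adj =
    subst (_≤ c) (∣⊤∣≡n m) (nonAdjacentCopy⇒∣p∣≤α f {⊤} (λ {x} _ → into x) (λ _ _ → f-inj) (λ {x} {y} _ _ → non-adj x y))

alphaAtMost⇒∣p∣<ramseyBound : ∀ (X : Graph) {D : Subset (n X)} {s w} → AlphaAtMost X D s → IsCliqueNumber X w →
                              ∣ D ∣ < ramseyBound (suc w) (suc s)
alphaAtMost⇒∣p∣<ramseyBound X {D} {s} {w} α≤s (_ , ω≤w) with ramseyBound (suc w) (suc s) ≤? ∣ D ∣
... | no small = ≰⇒> small
... | yes big with ramsey X (suc w) (suc s) D big
...   | inj₁ (K , _ , clique , size) = contradiction (≤-trans size (ω≤w K clique)) (<-irrefl refl)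
...   | inj₂ (I , I⊆D , indep , size) = contradiction (≤-trans size (α≤s I I⊆D indep)) (<-irrefl refl)

module _ (H Z : Graph) (copy : IsInducedSubgraphOf H Z) (C : Subset (n Z)) where

  private
    φ : Fin (n H) → Fin (n Z)
    φ = proj₁ copy
    φ-inj : Injective _≡_ _≡_ φ
    φ-inj = proj₁ (proj₂ copy)
    φ-adj : ∀ i j → adj Z (φ i) (φ j) ≡ adj H i j
    φ-adj = proj₂ (proj₂ copy)

  preimage : Subset (n H)
  preimage = subset (λ u → φ u ∈? C)

  preimage-isVertexCover : IsVertexCover Z C → IsVertexCover H preimage
  preimage-isVertexCover cover u v u~v with cover (φ u) (φ v) (trans (φ-adj u v) u~v)
  ... | inj₁ φu∈C = inj₁ (∈-subset⁺ (λ u → φ u ∈? C) φu∈C)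
  ... | inj₂ φv∈C = inj₂ (∈-subset⁺ (λ u → φ u ∈? C) φv∈C)

  preimage-alphaAtMost : ∀ {s} → AlphaAtMost Z C s → AlphaAtMost H preimage s
  preimage-alphaAtMost α≤s I I⊆ indep =
    nonAdjacentCopy⇒∣p∣≤α Z α≤s φ (∈-subset⁻ (λ u → φ u ∈? C) ∘ I⊆) (λ _ _ → φ-inj)
      (λ {x} {y} x∈ y∈ → trans (φ-adj x y) (indep x y x∈ y∈))

vertexCover⇒inducedTreewidthAtMost :
  ∀ (Z : Graph) {C : Subset (n Z)} {s} → IsVertexCover Z C → AlphaAtMost Z C s →
  ∀ H → IsInducedSubgraphOf H Z → ∀ w → IsCliqueNumber H w → TreewidthAtMost H (ramseyBound (suc w) (suc s))
vertexCover⇒inducedTreewidthAtMost Z {C} cover α≤s H copy w ω≡w =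
  vertexCover⇒treewidthAtMost H (preimage-isVertexCover H Z copy C cover)
    (<⇒≤ (alphaAtMost⇒∣p∣<ramseyBound H (preimage-alphaAtMost H Z copy C α≤s) ω≡w))

-- The Helly property for subtrees of a tree

record IsTreeAdj {N} (A : Fin N → Fin N → Bool) : Set where
  field
    symmetric   : ∀ i j → A i j ≡ A j i
    irreflexive : ∀ i → A i i ≡ false
    connected   : ∀ u v → Walk A (λ _ → Unit.⊤) u v
    acyclic     : ∀ k → 3 ≤ k → ¬ SubgraphCopy (cycleAdj k) A

isTree⇒isTreeAdj : (T : Graph) → IsTree T → IsTreeAdj (adj T)
isTree⇒isTreeAdj T (_ , connected , acyclic) = record
  { symmetric = adj-sym T ; irreflexive = adj-irrefl T ; connected = λ u v → connected u v tt tt ; acyclic = acyclic }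

ConnectedSubset : (Fin N → Fin N → Bool) → (Fin N → Set) → Set
ConnectedSubset A S = ∀ u v → S u → S v → Walk A S u v

adjacent⇒≢ : (A : Fin N → Fin N → Bool) → (∀ i → A i i ≡ false) → ∀ {u v} → A u v ≡ true → u ≢ v
adjacent⇒≢ A irreflexive {u} u~v refl = contradiction (trans (sym u~v) (irreflexive u)) λ ()

walk-source : {A : Fin N → Fin N → Bool} {S : Fin N → Set} {u v : Fin N} → Walk A S u v → S u
walk-source (here s) = s
walk-source (step s _ _) = s

IsPath : {k : ℕ} → (Fin N → Fin N → Bool) → (Fin k → Fin N) → Set
IsPath {k = k} A path = ∀ (i j : Fin k) → suc (toℕ i) ≡ toℕ j → A (path i) (path j) ≡ true

Leaf : (Fin N → Fin N → Bool) → Set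
Leaf {N} A = Σ (Fin N) λ ℓ → Σ (Fin N) λ p → A ℓ p ≡ true × (∀ w → A ℓ w ≡ true → w ≡ p)

path-closing⇒cycle : ∀ {k} {A : Fin N → Fin N → Bool} → (∀ i j → A i j ≡ A j i) →
                     (path : Fin (suc k) → Fin N) → Injective _≡_ _≡_ path → IsPath A path →
                     (i : Fin (suc k)) → A (path i) (path zero) ≡ true →
                     SubgraphCopy (cycleAdj (suc (toℕ i))) A
path-closing⇒cycle {N} {k} {A} symmetric path path-inj path-adj i closing = cycle , cycle-inj , cycle-adj
  where
  i<k : suc (toℕ i) ≤ suc k
  i<k = toℕ<n i
  cycle : Fin (suc (toℕ i)) → Fin N
  cycle j = path (inject≤ j i<k)
  cycle-inj : Injective _≡_ _≡_ cycle
  cycle-inj e = inject≤-injective i<k i<k _ _ (path-inj e)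
  toℕ-inject : ∀ j → toℕ (inject≤ j i<k) ≡ toℕ j
  toℕ-inject j = toℕ-inject≤ j i<k
  forward : ∀ j j′ → suc (toℕ j) ≡ toℕ j′ → A (cycle j) (cycle j′) ≡ true
  forward j j′ e = path-adj _ _ (trans (cong suc (toℕ-inject j)) (trans e (sym (toℕ-inject j′))))
  wrap-around : ∀ j j′ → toℕ j ≡ 0 → suc (toℕ j′) ≡ suc (toℕ i) → A (cycle j) (cycle j′) ≡ true
  wrap-around j j′ j≡0 j′≡i
    rewrite toℕ-injective {i = inject≤ j i<k} {j = zero} (trans (toℕ-inject j) j≡0)
          | toℕ-injective {i = inject≤ j′ i<k} {j = i} (trans (toℕ-inject j′) (ℕ.suc-injective j′≡i))
    = trans (symmetric _ _) closing
  cycle-adj : ∀ j j′ → cycleAdj (suc (toℕ i)) j j′ ≡ true → A (cycle j) (cycle j′) ≡ true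
  cycle-adj j j′ h with ∨-true⁻ _ _ h
  ... | inj₁ e = forward j j′ (≡ᵇ-true⁻ _ _ e)
  ... | inj₂ h′ with ∨-true⁻ _ _ h′
  ...   | inj₁ e = trans (symmetric _ _) (forward j′ j (≡ᵇ-true⁻ _ _ e))
  ...   | inj₂ h″ with ∨-true⁻ _ _ h″
  ...     | inj₁ e = wrap-around j j′ (≡ᵇ-true⁻ _ _ (proj₁ (∧-true⁻ _ _ e))) (≡ᵇ-true⁻ _ _ (proj₂ (∧-true⁻ _ _ e)))
  ...     | inj₂ e = trans (symmetric _ _)
                       (wrap-around j′ j (≡ᵇ-true⁻ _ _ (proj₁ (∧-true⁻ _ _ e))) (≡ᵇ-true⁻ _ _ (proj₂ (∧-true⁻ _ _ e))))

module _ {A : Fin N → Fin N → Bool} (tree : IsTreeAdj A) where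
  open IsTreeAdj tree

  Path : ℕ → Set
  Path k = Σ (Fin k → Fin N) λ path → Injective _≡_ _≡_ path × IsPath A path

  leaf-or-longerPath : ∀ {k} → Path (2 + k) → Leaf A ⊎ Path (3 + k)
  leaf-or-longerPath {k} (path , path-inj , path-adj)
    with any? (λ w → (A (path zero) w Bool.≟ true) ×-dec ¬? (any? (λ i → path i ≟ w)))
  ... | yes (w , path₀~w , w∉path) =
    inj₂ (starVertex w path , starVertex-injective path-inj (λ i e → w∉path (i , e)) , extended-adj)
    where
    extended-adj : IsPath A (starVertex w path)
    extended-adj zero (suc zero) _ = trans (symmetric _ _) path₀~w
    extended-adj (suc i) (suc j) e = path-adj i j (ℕ.suc-injective e)
  ... | no no-fresh-neighbour
    with any? (λ w → (A (path zero) w Bool.≟ true) ×-dec ¬? (w ≟ path (suc zero)))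
  ...   | no no-other-neighbour = inj₁ (path zero , path (suc zero) , path-adj zero (suc zero) refl , unique)
    where
    unique : ∀ w → A (path zero) w ≡ true → w ≡ path (suc zero)
    unique w path₀~w with w ≟ path (suc zero)
    ... | yes w≡path₁ = w≡path₁
    ... | no w≢path₁ = contradiction (w , path₀~w , w≢path₁) no-other-neighbour
  ...   | yes (w , path₀~w , w≢path₁) with any? (λ i → path i ≟ w)
  ...     | no w∉path = contradiction (w , path₀~w , w∉path) no-fresh-neighbour
  ...     | yes (i , pathᵢ≡w) = contradiction pathᵢ≡w (no-chord i)
    where
    -- a neighbour of the start further along the path closes a cycle
    no-chord : ∀ i → path i ≢ w
    no-chord zero pathᵢ≡w = adjacent⇒≢ A irreflexive path₀~w pathᵢ≡w
    no-chord (suc zero) pathᵢ≡w = w≢path₁ (sym pathᵢ≡w)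
    no-chord (suc (suc i)) refl =
      acyclic (3 + toℕ i) (s≤s (s≤s (s≤s z≤n)))
        (path-closing⇒cycle symmetric path path-inj path-adj (suc (suc i)) (trans (symmetric _ _) path₀~w))

  leaf-from-path : ∀ fuel {k} → N ≤ fuel + k → Path (2 + k) → Leaf A
  leaf-from-path zero {k} N≤k (path , path-inj , _) =
    contradiction (≤-trans (n≤1+n (suc k)) (≤-trans (injective⇒≤ path-inj) N≤k)) (<-irrefl refl)
  leaf-from-path (suc fuel) {k} N≤ p with leaf-or-longerPath p
  ... | inj₁ leaf = leaf
  ... | inj₂ p′ = leaf-from-path fuel (subst (N ≤_) (sym (+-suc fuel k)) N≤) p′

  two-nodes⇒leaf : (u v : Fin N) → u ≢ v → Leaf A
  two-nodes⇒leaf u v u≢v with connected u v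
  ... | here _ = contradiction refl u≢v
  ... | step {w = w} _ u~w _ = leaf-from-path N (m≤m+n N 0) (path , path-inj , path-adj)
    where
    path : Fin 2 → Fin N
    path zero = w
    path (suc zero) = u
    path-inj : Injective _≡_ _≡_ path
    path-inj {zero} {zero} _ = refl
    path-inj {zero} {suc zero} e = contradiction (sym e) (adjacent⇒≢ A irreflexive u~w)
    path-inj {suc zero} {zero} e = contradiction e (adjacent⇒≢ A irreflexive u~w)
    path-inj {suc zero} {suc zero} _ = refl
    path-adj : IsPath A path
    path-adj zero (suc zero) _ = trans (symmetric _ _) u~w

record Subtrees (A : Fin N → Fin N → Bool) (k : ℕ) : Set₁ where
  field
    member    : Fin k → Fin N → Set
    member?   : ∀ a t → Dec (member a t)
    subtree   : ∀ a → ConnectedSubset A (member a)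
open Subtrees

CommonNode : {A : Fin N → Fin N → Bool} {k : ℕ} → Subtrees A k → Set
CommonNode {N} F = ∃ λ (t : Fin N) → ∀ a → member F a t

Meet : {A : Fin N → Fin N → Bool} {k k′ : ℕ} → Subtrees A k → Subtrees A k′ → Set
Meet F G = ∀ a b → ∃ λ t → member F a t × member G b t

module RemoveLeaf {N} {A : Fin (suc N) → Fin (suc N) → Bool} (tree : IsTreeAdj A)
                  {ℓ p : Fin (suc N)} (ℓ~p : A ℓ p ≡ true) (unique : ∀ w → A ℓ w ≡ true → w ≡ p) where
  open IsTreeAdj tree

  A′ : Fin N → Fin N → Bool
  A′ i j = A (punchIn ℓ i) (punchIn ℓ j)

  ℓ≢p : ℓ ≢ p
  ℓ≢p = adjacent⇒≢ A irreflexive ℓ~p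

  -- a walk through the leaf ℓ enters and leaves it via p, so the detour can be cut out
  avoid-leaf : ∀ {S : Fin (suc N) → Set} {u v} → Walk A S u v → ∀ u′ v′ →
               punchIn ℓ u′ ≡ u → punchIn ℓ v′ ≡ v → Walk A′ (S ∘ punchIn ℓ) u′ v′
  avoid-leaf {S} (here s) u′ v′ eu ev with punchIn-injective ℓ u′ v′ (trans eu (sym ev))
  ... | refl = here (subst S (sym eu) s)
  avoid-leaf {S} (step {w = w} s u~w rest) u′ v′ eu ev with ℓ ≟ w
  ... | no ℓ≢w = step (subst S (sym eu) s) u′~w (avoid-leaf rest (punchOut ℓ≢w) v′ (punchIn-punchOut ℓ≢w) ev)
    where
    u′~w : A (punchIn ℓ u′) (punchIn ℓ (punchOut ℓ≢w)) ≡ true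
    u′~w rewrite punchIn-punchOut ℓ≢w | eu = u~w
  avoid-leaf (step s _ (here _)) u′ v′ eu ev | yes refl = contradiction ev (punchInᵢ≢i ℓ v′)
  avoid-leaf {u = u} (step s u~ℓ (step {w = w} _ ℓ~w rest)) u′ v′ eu ev | yes refl =
    avoid-leaf rest u′ v′ (trans eu (trans (unique u (trans (symmetric _ _) u~ℓ)) (sym (unique w ℓ~w)))) ev

  tree′ : IsTreeAdj A′
  tree′ = record
    { symmetric = λ i j → symmetric _ _
    ; irreflexive = λ i → irreflexive _
    ; connected = λ u v → avoid-leaf (connected (punchIn ℓ u) (punchIn ℓ v)) u v refl refl
    ; acyclic = λ k 3≤k (f , f-inj , f-adj) →
        acyclic k 3≤k (punchIn ℓ ∘ f , f-inj ∘ punchIn-injective ℓ _ _ , f-adj)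
    }

  restrict : ∀ {k} → Subtrees A k → Subtrees A′ k
  restrict F = record
    { member = λ a t → member F a (punchIn ℓ t)
    ; member? = λ a t → member? F a (punchIn ℓ t)
    ; subtree = λ a u v su sv → avoid-leaf (subtree F a _ _ su sv) u v refl refl
    }

  Escapes : ∀ {k} → Subtrees A k → Fin k → Set
  Escapes F a = ∃ λ t → t ≢ ℓ × member F a t

  escapes⇒p-member : ∀ {k} (F : Subtrees A k) a → Escapes F a → member F a ℓ → member F a p
  escapes⇒p-member F a (t , t≢ℓ , t∈) ℓ∈ with subtree F a ℓ t ℓ∈ t∈
  ... | here _ = contradiction refl t≢ℓ
  ... | step {w = w} _ ℓ~w rest = subst (member F a) (unique w ℓ~w) (walk-source rest)

  escapes? : ∀ {k} (F : Subtrees A k) a → Dec (Escapes F a)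
  escapes? F a = any? (λ t → ¬? (t ≟ ℓ) ×-dec member? F a t)

  everyone-escapes : ∀ {k} (F : Subtrees A k) → ¬ (∃ λ a → ¬ Escapes F a) → ∀ a → Escapes F a
  everyone-escapes F none-confined a = decidable-stable (escapes? F a) (λ confined → none-confined (a , confined))

  confined⇒ℓ-common : ∀ {k k′} (F : Subtrees A k) (G : Subtrees A k′) a → ¬ Escapes F a →
                      (∀ b → ∃ λ t → member F a t × member G b t) → CommonNode G
  confined⇒ℓ-common F G a confined meets = ℓ , λ b → at-ℓ (meets b)
    where
    at-ℓ : ∀ {b} → (∃ λ t → member F a t × member G b t) → member G b ℓ
    at-ℓ (t , t∈F , t∈G) with t ≟ ℓ
    ... | yes refl = t∈G
    ... | no t≢ℓ = contradiction (t , t≢ℓ , t∈F) confined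

  restrict-meet : ∀ {k k′} {F : Subtrees A k} {G : Subtrees A k′} → (∀ a → Escapes F a) → (∀ b → Escapes G b) →
                  Meet F G → Meet (restrict F) (restrict G)
  restrict-meet {F = F} {G} escF escG meet a b with meet a b
  ... | t , t∈F , t∈G with ℓ ≟ t
  ...   | no ℓ≢t = punchOut ℓ≢t , subst (member F a) (sym (punchIn-punchOut ℓ≢t)) t∈F
                                 , subst (member G b) (sym (punchIn-punchOut ℓ≢t)) t∈G
  ...   | yes refl = punchOut ℓ≢p , subst (member F a) (sym (punchIn-punchOut ℓ≢p)) (escapes⇒p-member F a (escF a) t∈F)
                                   , subst (member G b) (sym (punchIn-punchOut ℓ≢p)) (escapes⇒p-member G b (escG b) t∈G)

  unrestrict : ∀ {k} {F : Subtrees A k} → CommonNode (restrict F) → CommonNode F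
  unrestrict (t , t∈) = punchIn ℓ t , t∈

  -- if some subtree is just ℓ, then ℓ is common to the other family; otherwise
  -- every subtree survives the removal of ℓ, and the restricted families still meet
  remove-leaf-helly : ∀ {k k′} (F : Subtrees A k) (G : Subtrees A k′) → Meet F G →
                      (Meet (restrict F) (restrict G) → CommonNode (restrict F) ⊎ CommonNode (restrict G)) →
                      CommonNode F ⊎ CommonNode G
  remove-leaf-helly F G meet helly′ with any? (λ a → ¬? (escapes? F a))
  ... | yes (a , confined) = inj₂ (confined⇒ℓ-common F G a confined (meet a))
  ... | no F-escapes with any? (λ b → ¬? (escapes? G b))
  ...   | yes (b , confined) = inj₁ (confined⇒ℓ-common G F b confined (λ a → map₂ swap (meet a b)))
  ...   | no G-escapes with helly′ (restrict-meet {F = F} {G} (everyone-escapes F F-escapes) (everyone-escapes G G-escapes) meet)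
  ...     | inj₁ common = inj₁ (unrestrict {F = F} common)
  ...     | inj₂ common = inj₂ (unrestrict {F = G} common)

helly : ∀ M {A : Fin (suc M) → Fin (suc M) → Bool} → IsTreeAdj A →
        ∀ {k k′} (F : Subtrees A k) (G : Subtrees A k′) → Meet F G → CommonNode F ⊎ CommonNode G
helly zero _ {k′ = zero} F G _ = inj₂ (zero , λ ())
helly zero _ {k′ = suc k′} F G meet = inj₁ (zero , λ a → at-zero (meet a zero))
  where
  at-zero : ∀ {a} → (∃ λ t → member F a t × member G zero t) → member F a zero
  at-zero (zero , t∈F , _) = t∈F
helly (suc M) tree F G meet with two-nodes⇒leaf tree zero (suc zero) (λ ())
... | ℓ , p , ℓ~p , unique = remove-leaf-helly F G meet (helly M tree′ (restrict F) (restrict G))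
  where open RemoveLeaf tree ℓ~p unique

data View (m k : ℕ) : Fin (m + k) → Set where
  left  : ∀ i → View m k (i ↑ˡ k)
  right : ∀ j → View m k (m ↑ʳ j)

view : ∀ m k i → View m k i
view m k i with splitAt m i in eq
... | inj₁ i′ = subst (View m k) (splitAt⁻¹-↑ˡ eq) (left i′)
... | inj₂ j = subst (View m k) (splitAt⁻¹-↑ʳ eq) (right j)

↑ˡ≢↑ʳ : ∀ m k (i : Fin m) (j : Fin k) → i ↑ˡ k ≢ m ↑ʳ j
↑ˡ≢↑ʳ m k i j e with trans (sym (splitAt-↑ˡ m i k)) (trans (cong (splitAt m) e) (splitAt-↑ʳ m k j))
... | ()

side-↑ˡ : ∀ s t (i : Fin s) → side s {t} (i ↑ˡ t) ≡ true
side-↑ˡ s t i rewrite splitAt-↑ˡ s i t = refl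

side-↑ʳ : ∀ s t (j : Fin t) → side s {t} (s ↑ʳ j) ≡ false
side-↑ʳ s t j rewrite splitAt-↑ʳ s t j = refl

module _ (s : ℕ) where

  Kss-ll : ∀ (i j : Fin s) → Kss s (i ↑ˡ s) (j ↑ˡ s) ≡ false
  Kss-ll i j rewrite side-↑ˡ s s i | side-↑ˡ s s j = refl

  Kss-rr : ∀ (i j : Fin s) → Kss s (s ↑ʳ i) (s ↑ʳ j) ≡ false
  Kss-rr i j rewrite side-↑ʳ s s i | side-↑ʳ s s j = refl

  Kss-lr : ∀ (i j : Fin s) → Kss s (i ↑ˡ s) (s ↑ʳ j) ≡ true
  Kss-lr i j rewrite side-↑ˡ s s i | side-↑ʳ s s j = refl

  Kss-rl : ∀ (i j : Fin s) → Kss s (s ↑ʳ i) (j ↑ˡ s) ≡ true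
  Kss-rl i j rewrite side-↑ʳ s s i | side-↑ˡ s s j = refl

completeBipartite : ℕ → Graph
completeBipartite s = record
  { n = s + s
  ; adj = Kss s
  ; adj-sym = λ i j → Bool.xor-comm (side s i) (side s j)
  ; adj-irrefl = λ i → Bool.xor-same (side s i)
  }

module _ (X : Graph) (D : TreeDecomposition X) where

  occurrences : ∀ {k} → (Fin k → Fin (n X)) → Subtrees (adj (tree D)) k
  occurrences f = record
    { member = λ a t → f a ∈ bag D t
    ; member? = λ a t → f a ∈? bag D t
    ; subtree = λ a → connected-occ D (f a)
    }

  completePair⇒inOneBag : ∀ {k k′} (f : Fin k → Fin (n X)) (g : Fin k′ → Fin (n X)) →
                          (∀ a b → adj X (f a) (g b) ≡ true) →
                          (∃ λ t → ∀ a → f a ∈ bag D t) ⊎ (∃ λ t → ∀ b → g b ∈ bag D t)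
  completePair⇒inOneBag f g complete =
    helly′ (proj₁ (isTree D)) (isTree⇒isTreeAdj (tree D) (isTree D)) (occurrences f) (occurrences g)
           (λ a b → covers-edges D (f a) (g b) (complete a b))
    where
    helly′ : ∀ {N} {A : Fin N → Fin N → Bool} → 1 ≤ N → IsTreeAdj A →
             ∀ {k k′} (F : Subtrees A k) (G : Subtrees A k′) → Meet F G → CommonNode F ⊎ CommonNode G
    helly′ {suc M} _ = helly M

module _ {s : ℕ} (Z : Graph) (copy : InducedCopy (Kss s) (adj Z)) where

  private
    φ : Fin (s + s) → Fin (n Z)
    φ = proj₁ copy
    φ-inj : Injective _≡_ _≡_ φ
    φ-inj = proj₁ (proj₂ copy)
    φ-adj : ∀ i j → adj Z (φ i) (φ j) ≡ Kss s i j
    φ-adj = proj₂ (proj₂ copy)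

    leftPart rightPart : Fin s → Fin (n Z)
    leftPart i = φ (i ↑ˡ s)
    rightPart j = φ (s ↑ʳ j)

    leftPart-inj : ∀ {i j} → leftPart i ≡ leftPart j → i ≡ j
    leftPart-inj = ↑ˡ-injective s _ _ ∘ φ-inj

    rightPart-inj : ∀ {i j} → rightPart i ≡ rightPart j → i ≡ j
    rightPart-inj = ↑ʳ-injective s _ _ ∘ φ-inj

    complete : ∀ i j → adj Z (leftPart i) (rightPart j) ≡ true
    complete i j = trans (φ-adj _ _) (Kss-lr s i j)

  Kss-copy⇒s≤treewidth+1 : ∀ {k} → TreewidthAtMost Z k → s ≤ suc k
  Kss-copy⇒s≤treewidth+1 (D , bag≤) with completePair⇒inOneBag Z D leftPart rightPart complete
  ... | inj₁ (t , ⊆bag) = ≤-trans (injective⇒≤∣q∣ leftPart leftPart-inj ⊆bag) (bag≤ t)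
  ... | inj₂ (t , ⊆bag) = ≤-trans (injective⇒≤∣q∣ rightPart rightPart-inj ⊆bag) (bag≤ t)

  Kss-copy⇒s≤treeAlpha : ∀ {c} → TreeAlphaAtMost Z c → s ≤ c
  Kss-copy⇒s≤treeAlpha (D , α≤c) with completePair⇒inOneBag Z D leftPart rightPart complete
  ... | inj₁ (t , ⊆bag) = nonAdjacentFamily⇒≤α Z (α≤c t) leftPart leftPart-inj ⊆bag (λ i j → trans (φ-adj _ _) (Kss-ll s i j))
  ... | inj₂ (t , ⊆bag) = nonAdjacentFamily⇒≤α Z (α≤c t) rightPart rightPart-inj ⊆bag (λ i j → trans (φ-adj _ _) (Kss-rr s i j))

module _ (s : ℕ) where

  private
    toFin : Bool → Fin 2
    toFin false = zero
    toFin true = suc zero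

    toFin-injective : ∀ {a b} → toFin a ≡ toFin b → a ≡ b
    toFin-injective {false} {false} _ = refl
    toFin-injective {true} {true} _ = refl

    Kss-same-side : ∀ u v → side s u ≡ side s v → Kss s u v ≡ false
    Kss-same-side u v e = trans (cong (_xor side s v) e) (Bool.xor-same (side s v))

  completeBipartite-clique≤2 : ∀ C → IsClique (completeBipartite s) C → ∣ C ∣ ≤ 2
  completeBipartite-clique≤2 C clique =
    subst (∣ C ∣ ≤_) (∣⊤∣≡n 2) (injectiveOn⇒∣p∣≤∣q∣ (toFin ∘ side s) (λ _ → ∈⊤) one-per-side)
    where
    one-per-side : ∀ {u v} → u ∈ C → v ∈ C → toFin (side s u) ≡ toFin (side s v) → u ≡ v
    one-per-side {u} {v} u∈ v∈ e with u ≟ v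
    ... | yes u≡v = u≡v
    ... | no u≢v = contradiction (trans (sym (clique u v u∈ v∈ u≢v)) (Kss-same-side u v (toFin-injective e))) λ ()

completeBipartite-cliqueNumber : ∀ s → IsCliqueNumber (completeBipartite (suc s)) 2
completeBipartite-cliqueNumber s′ =
  (⁅ x ⁆ ∪ ⁅ y ⁆ , edge-clique , ≤-antisym (completeBipartite-clique≤2 s _ edge-clique) 2≤∣edge∣)
  , completeBipartite-clique≤2 s
  where
  s : ℕ
  s = suc s′
  x y : Fin (s + s)
  x = zero ↑ˡ s
  y = s ↑ʳ zero
  endpoint : ∀ {u} → u ∈ ⁅ x ⁆ ∪ ⁅ y ⁆ → u ≡ x ⊎ u ≡ y
  endpoint u∈ with x∈p∪q⁻ ⁅ x ⁆ ⁅ y ⁆ u∈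
  ... | inj₁ u∈x = inj₁ (x∈⁅y⁆⇒x≡y x u∈x)
  ... | inj₂ u∈y = inj₂ (x∈⁅y⁆⇒x≡y y u∈y)
  edge-clique : IsClique (completeBipartite s) (⁅ x ⁆ ∪ ⁅ y ⁆)
  edge-clique u v u∈ v∈ u≢v with endpoint u∈ | endpoint v∈
  ... | inj₁ refl | inj₁ refl = contradiction refl u≢v
  ... | inj₂ refl | inj₂ refl = contradiction refl u≢v
  ... | inj₁ refl | inj₂ refl = Kss-lr s zero zero
  ... | inj₂ refl | inj₁ refl = Kss-rl s zero zero
  2≤∣edge∣ : 2 ≤ ∣ ⁅ x ⁆ ∪ ⁅ y ⁆ ∣
  2≤∣edge∣ = subst (λ m → suc m ≤ ∣ ⁅ x ⁆ ∪ ⁅ y ⁆ ∣) (∣⁅x⁆∣≡1 x)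
               (x∉p⇒∣p∣<∣p∪⁅x⁆∣ ⁅ x ⁆ (λ y∈x → ↑ˡ≢↑ʳ s s zero zero (sym (x∈⁅y⁆⇒x≡y x y∈x))))

unique⇒lookup-injective : ∀ {A : Set} {xs : List A} → Unique xs → ∀ i j → lookup xs i ≡ lookup xs j → i ≡ j
unique⇒lookup-injective (_ ∷ _) zero zero _ = refl
unique⇒lookup-injective (x∉xs ∷ _) zero (suc j) e = contradiction e (All.lookup x∉xs (∈-lookup j))
unique⇒lookup-injective (x∉xs ∷ _) (suc i) zero e = contradiction (sym e) (All.lookup x∉xs (∈-lookup i))
unique⇒lookup-injective (_ ∷ u) (suc i) (suc j) e = cong suc (unique⇒lookup-injective u i j e)

concatMap≡cartesianProduct : ∀ {A B : Set} (xs : List A) (ys : List B) →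
                             concatMap (λ x → map (x ,_) ys) xs ≡ cartesianProduct xs ys
concatMap≡cartesianProduct [] ys = refl
concatMap≡cartesianProduct (x ∷ xs) ys = cong (map (x ,_) ys ++_) (concatMap≡cartesianProduct xs ys)

EndOf : ∀ {m} → Fin m → Edge m → Set
EndOf v (x , y) = v ≡ x ⊎ v ≡ y

share⁻ : ∀ {m} (e f : Edge m) → share e f ≡ true → ∃ λ v → EndOf v e × EndOf v f
share⁻ (x , y) (x′ , y′) h with ∨-true⁻ (x == x′) _ h
... | inj₁ e = x , inj₁ refl , inj₁ (==⇒≡ e)
... | inj₂ h′ with ∨-true⁻ (x == y′) _ h′
...   | inj₁ e = x , inj₁ refl , inj₂ (==⇒≡ e)
...   | inj₂ h″ with ∨-true⁻ (y == x′) _ h″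
...     | inj₁ e = y , inj₂ refl , inj₁ (==⇒≡ e)
...     | inj₂ e = y , inj₂ refl , inj₂ (==⇒≡ e)

share⁺ : ∀ {m} (e f : Edge m) {v} → EndOf v e → EndOf v f → share e f ≡ true
share⁺ (x , y) (x′ , y′) (inj₁ refl) (inj₁ refl) = ∨-trueˡ _ (==-refl x)
share⁺ (x , y) (x′ , y′) (inj₁ refl) (inj₂ refl) = ∨-trueʳ (x == x′) (∨-trueˡ _ (==-refl x))
share⁺ (x , y) (x′ , y′) (inj₂ refl) (inj₁ refl) = ∨-trueʳ (x == y) (∨-trueʳ (x == y′) (∨-trueˡ _ (==-refl y)))
share⁺ (x , y) (x′ , y′) (inj₂ refl) (inj₂ refl) = ∨-trueʳ (x == x′) (∨-trueʳ (x == y) (∨-trueʳ (y == x′) (==-refl y)))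

module _ (G : Graph) where

  V E : Set
  V = Fin (n G)
  E = Fin (n (coLine G))

  private
    IsEdge? : (p : V × V) → Dec ((proj₁ p Fin.< proj₂ p) × adj G (proj₁ p) (proj₂ p) ≡ true)
    IsEdge? p = (proj₁ p <? proj₂ p) ×-dec (adj G (proj₁ p) (proj₂ p) Bool.≟ true)
    allPairs : List (V × V)
    allPairs = concatMap (λ i → map (i ,_) (allFin (n G))) (allFin (n G))

  ends : E → V × V
  ends e = lookup (edgeList G) e

  ends-isEdge : ∀ e → (proj₁ (ends e) Fin.< proj₂ (ends e)) × adj G (proj₁ (ends e)) (proj₂ (ends e)) ≡ true
  ends-isEdge e = proj₂ (∈-filter⁻ IsEdge? {xs = allPairs} (∈-lookup e))

  ends-injective : ∀ a b → ends a ≡ ends b → a ≡ b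
  ends-injective = unique⇒lookup-injective (filter⁺ IsEdge?
    (subst Unique (sym (concatMap≡cartesianProduct (allFin (n G)) (allFin (n G))))
           (cartesianProduct⁺ (allFin⁺ _) (allFin⁺ _))))

  ends-surjective : ∀ u v → u Fin.< v → adj G u v ≡ true → ∃ λ e → ends e ≡ (u , v)
  ends-surjective u v u<v u~v = index uv∈edges , sym (lookup-index uv∈edges)
    where
    uv∈edges : (u , v) List.∈ edgeList G
    uv∈edges = ∈-filter⁺ IsEdge?
      (subst ((u , v) List.∈_) (sym (concatMap≡cartesianProduct (allFin (n G)) (allFin (n G))))
             (∈-cartesianProduct⁺ (∈-allFin u) (∈-allFin v)))
      (u<v , u~v)

  Incident : V → E → Set
  Incident v e = EndOf v (ends e)

  incident? : ∀ v e → Dec (Incident v e)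
  incident? v e with v ≟ proj₁ (ends e) | v ≟ proj₂ (ends e)
  ... | yes p | _ = yes (inj₁ p)
  ... | no _ | yes q = yes (inj₂ q)
  ... | no p | no q = no λ { (inj₁ x) → p x ; (inj₂ x) → q x }

  ends-distinct : ∀ e → proj₁ (ends e) ≢ proj₂ (ends e)
  ends-distinct e = <⇒≢ (proj₁ (ends-isEdge e))

  Intersect : E → E → Set
  Intersect a b = ∃ λ v → Incident v a × Incident v b

  Intersect-sym : ∀ {a b} → Intersect a b → Intersect b a
  Intersect-sym (v , v∈a , v∈b) = v , v∈b , v∈a

  only-two-ends : ∀ {x w e} → Incident x e → Incident w e → x ≢ w → ∀ v → Incident v e → v ≡ x ⊎ v ≡ w
  only-two-ends (inj₁ a) (inj₁ b) x≢w _ _ = contradiction (trans a (sym b)) x≢w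
  only-two-ends (inj₂ a) (inj₂ b) x≢w _ _ = contradiction (trans a (sym b)) x≢w
  only-two-ends (inj₁ a) (inj₂ b) _ v (inj₁ c) = inj₁ (trans c (sym a))
  only-two-ends (inj₁ a) (inj₂ b) _ v (inj₂ c) = inj₂ (trans c (sym b))
  only-two-ends (inj₂ a) (inj₁ b) _ v (inj₁ c) = inj₂ (trans c (sym b))
  only-two-ends (inj₂ a) (inj₁ b) _ v (inj₂ c) = inj₁ (trans c (sym a))

  incident-⊆⇒≡ : ∀ a b → (∀ v → Incident v a → Incident v b) → a ≡ b
  incident-⊆⇒≡ a b a⊆b with a⊆b _ (inj₁ refl) | a⊆b _ (inj₂ refl)
  ... | inj₁ e₁ | inj₂ e₂ = ends-injective a b (cong₂ _,_ e₁ e₂)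
  ... | inj₁ e₁ | inj₁ e₂ = contradiction (trans e₁ (sym e₂)) (ends-distinct a)
  ... | inj₂ e₁ | inj₂ e₂ = contradiction (trans e₁ (sym e₂)) (ends-distinct a)
  ... | inj₂ e₁ | inj₁ e₂ =
    contradiction (subst₂ Fin._<_ (sym e₂) (sym e₁) (proj₁ (ends-isEdge b))) (<-asym (proj₁ (ends-isEdge a)))

  two-incident⇒≡ : ∀ {x w a b} → x ≢ w → Incident x a → Incident w a → Incident x b → Incident w b → a ≡ b
  two-incident⇒≡ {x} {w} {a} {b} x≢w x∈a w∈a x∈b w∈b = incident-⊆⇒≡ a b λ v v∈a → from (only-two-ends x∈a w∈a x≢w v v∈a)
    where
    from : ∀ {v} → v ≡ x ⊎ v ≡ w → Incident v b
    from (inj₁ refl) = x∈b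
    from (inj₂ refl) = w∈b

  edgeBetween : ∀ u v → adj G u v ≡ true → ∃ λ e → Incident u e × Incident v e
  edgeBetween u v u~v with <-cmp u v
  ... | tri< u<v _ _ with ends-surjective u v u<v u~v
  ...   | e , refl = e , inj₁ refl , inj₂ refl
  edgeBetween u v u~v | tri≈ _ refl _ = contradiction (trans (sym u~v) (adj-irrefl G u)) λ ()
  edgeBetween u v u~v | tri> _ _ v<u with ends-surjective v u v<u (trans (adj-sym G v u) u~v)
  ...   | e , refl = e , inj₂ refl , inj₁ refl

  otherEnd : V → E → V
  otherEnd c e with c ≟ proj₁ (ends e)
  ... | yes _ = proj₂ (ends e)
  ... | no _ = proj₁ (ends e)

  otherEnd-spec : ∀ c e → Incident c e →
                  adj G c (otherEnd c e) ≡ true × otherEnd c e ≢ c × Incident (otherEnd c e) e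
  otherEnd-spec c e c∈e with c ≟ proj₁ (ends e)
  ... | yes refl = proj₂ (ends-isEdge e) , (λ q → ends-distinct e (sym q)) , inj₂ refl
  ... | no c≢x with c∈e
  ...   | inj₁ c≡x = contradiction c≡x c≢x
  ...   | inj₂ refl = trans (adj-sym G _ _) (proj₂ (ends-isEdge e)) , ends-distinct e , inj₁ refl

  share⇒Intersect : ∀ a b → share (ends a) (ends b) ≡ true → Intersect a b
  share⇒Intersect a b = share⁻ (ends a) (ends b)

  Intersect⇒share : ∀ a b → Intersect a b → share (ends a) (ends b) ≡ true
  Intersect⇒share a b (v , v∈a , v∈b) = share⁺ (ends a) (ends b) v∈a v∈b

  coLine-adj : ∀ a b → adj (coLine G) a b ≡ not (share (ends a) (ends b))
  coLine-adj a b = complement-of-reflexive (a == b) (share (ends a) (ends b)) diagonal-shares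
    where
    complement-of-reflexive : ∀ c s → (c ≡ true → s ≡ true) → (not c ∧ not (not c ∧ s)) ≡ not s
    complement-of-reflexive true true _ = refl
    complement-of-reflexive true false c⇒s = contradiction (c⇒s refl) λ ()
    complement-of-reflexive false _ _ = refl
    diagonal-shares : (a == b) ≡ true → share (ends a) (ends b) ≡ true
    diagonal-shares a==b with ==⇒≡ a==b
    ... | refl = Intersect⇒share a a (proj₁ (ends a) , inj₁ refl , inj₁ refl)

  coLine-adjacent⇒disjoint : ∀ a b → adj (coLine G) a b ≡ true → ¬ Intersect a b
  coLine-adjacent⇒disjoint a b a~b ab-meet =
    contradiction (trans (sym a~b) (trans (coLine-adj a b) (cong not (Intersect⇒share a b ab-meet)))) λ ()

  disjoint⇒coLine-adjacent : ∀ a b → ¬ Intersect a b → adj (coLine G) a b ≡ true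
  disjoint⇒coLine-adjacent a b disjoint =
    trans (coLine-adj a b) (cong not (Bool.¬-not (disjoint ∘ share⇒Intersect a b)))

  coLine-nonadjacent⇒Intersect : ∀ a b → adj (coLine G) a b ≡ false → Intersect a b
  coLine-nonadjacent⇒Intersect a b a≁b =
    share⇒Intersect a b (Bool.not-injective (trans (sym (coLine-adj a b)) a≁b))

  Intersect⇒coLine-nonadjacent : ∀ a b → Intersect a b → adj (coLine G) a b ≡ false
  Intersect⇒coLine-nonadjacent a b ab-meet = trans (coLine-adj a b) (cong not (Intersect⇒share a b ab-meet))

-- Pairwise intersecting edges

module _ (G : Graph) where

  CommonEnd : (E G → Set) → Set
  CommonEnd P = ∃ λ x → ∀ a → P a → Incident G x a

  -- a meets a₁ = yw in w, and so does a₂, hence a = a₂ = xw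
  through-x-only : ∀ {x y a a₁ a₂} → Incident G x a → ¬ Incident G y a →
                   ¬ Incident G x a₁ → Incident G y a₁ → Incident G x a₂ → ¬ Incident G y a₂ →
                   Intersect G a a₁ → Intersect G a₂ a₁ → a ≡ a₂
  through-x-only {x} {y} {a} {a₁} {a₂} x∈a y∉a x∉a₁ y∈a₁ x∈a₂ y∉a₂ (w , w∈a , w∈a₁) (u , u∈a₂ , u∈a₁) =
    two-incident⇒≡ G x≢w x∈a w∈a x∈a₂ w∈a₂
    where
    x≢w : x ≢ w
    x≢w refl = x∉a₁ w∈a₁
    w∈a₂ : Incident G w a₂
    w∈a₂ with only-two-ends G y∈a₁ w∈a₁ (λ { refl → y∉a w∈a }) u u∈a₁
    ... | inj₁ refl = contradiction u∈a₂ y∉a₂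
    ... | inj₂ refl = u∈a₂

  AtMostThree : E G → (E G → Set) → Set
  AtMostThree e₀ P = ∃ λ e₁ → ∃ λ e₂ → ∀ a → P a → a ≡ e₀ ⊎ a ≡ e₁ ⊎ a ≡ e₂

  module Intersecting {P : E G → Set} (P? : Decidable P) (intersecting : ∀ a b → P a → P b → Intersect G a b)
                      {e₀ : E G} (e₀∈P : P e₀) where

    x y : V G
    x = proj₁ (ends G e₀)
    y = proj₂ (ends G e₀)

    Avoider : V G → Set
    Avoider v = ∃ λ a → P a × ¬ Incident G v a

    avoider? : ∀ v → Dec (Avoider v)
    avoider? v = any? (λ a → P? a ×-dec ¬? (incident? G v a))

    no-avoider⇒commonEnd : ∀ {v} → ¬ Avoider v → CommonEnd P
    no-avoider⇒commonEnd {v} none = v , λ a a∈P → decidable-stable (incident? G v a) (λ v∉a → none (a , a∈P , v∉a))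

    x-or-y : ∀ {a} → P a → Incident G x a ⊎ Incident G y a
    x-or-y {a} a∈P with intersecting a e₀ a∈P e₀∈P
    ... | v , v∈a , inj₁ refl = inj₁ v∈a
    ... | v , v∈a , inj₂ refl = inj₂ v∈a

    avoiders⇒atMostThree : Avoider x → Avoider y → AtMostThree e₀ P
    avoiders⇒atMostThree (a₁ , a₁∈P , x∉a₁) (a₂ , a₂∈P , y∉a₂) = a₁ , a₂ , classify
      where
      y∈a₁ : Incident G y a₁
      y∈a₁ with x-or-y a₁∈P
      ... | inj₁ x∈a₁ = contradiction x∈a₁ x∉a₁
      ... | inj₂ y∈a₁ = y∈a₁
      x∈a₂ : Incident G x a₂
      x∈a₂ with x-or-y a₂∈P
      ... | inj₁ x∈a₂ = x∈a₂
      ... | inj₂ y∈a₂ = contradiction y∈a₂ y∉a₂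
      classify : ∀ a → P a → a ≡ e₀ ⊎ a ≡ a₁ ⊎ a ≡ a₂
      classify a a∈P with incident? G x a | incident? G y a
      ... | yes x∈a | yes y∈a = inj₁ (two-incident⇒≡ G (ends-distinct G e₀) x∈a y∈a (inj₁ refl) (inj₂ refl))
      ... | yes x∈a | no y∉a = inj₂ (inj₂ (through-x-only x∈a y∉a x∉a₁ y∈a₁ x∈a₂ y∉a₂
                                             (intersecting a a₁ a∈P a₁∈P) (intersecting a₂ a₁ a₂∈P a₁∈P)))
      ... | no x∉a | yes y∈a = inj₂ (inj₁ (through-x-only y∈a x∉a y∉a₂ x∈a₂ y∈a₁ x∉a₁
                                             (intersecting a a₂ a∈P a₂∈P) (intersecting a₁ a₂ a₁∈P a₂∈P)))
      ... | no x∉a | no y∉a with x-or-y a∈P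
      ...   | inj₁ x∈a = contradiction x∈a x∉a
      ...   | inj₂ y∈a = contradiction y∈a y∉a

    commonEnd-or-atMostThree : Dec (Avoider x) → Dec (Avoider y) → CommonEnd P ⊎ AtMostThree e₀ P
    commonEnd-or-atMostThree (no none) _ = inj₁ (no-avoider⇒commonEnd none)
    commonEnd-or-atMostThree _ (no none) = inj₁ (no-avoider⇒commonEnd none)
    commonEnd-or-atMostThree (yes x-avoider) (yes y-avoider) = inj₂ (avoiders⇒atMostThree x-avoider y-avoider)

  intersecting⇒commonEnd-or-three : {P : E G → Set} → Decidable P → (∀ a b → P a → P b → Intersect G a b) →
                                    ∀ {e₀} → P e₀ → CommonEnd P ⊎ AtMostThree e₀ P
  intersecting⇒commonEnd-or-three P? intersecting e₀∈P = commonEnd-or-atMostThree (avoider? x) (avoider? y)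
    where open Intersecting P? intersecting e₀∈P

  large-intersecting⇒commonEnd : ∀ {s} (f : Fin (4 + s) → E G) → Injective _≡_ _≡_ f →
                                 (∀ i j → Intersect G (f i) (f j)) → ∃ λ c → ∀ i → Incident G c (f i)
  large-intersecting⇒commonEnd f f-inj intersecting
    with intersecting⇒commonEnd-or-three (λ a → any? (λ i → f i ≟ a))
           (λ { _ _ (i , refl) (j , refl) → intersecting i j }) (zero , refl)
  ... | inj₁ (c , through-c) = c , λ i → through-c (f i) (i , refl)
  ... | inj₂ (e₁ , e₂ , triangle)
    with ≤-trans (injective⇒≤∣q∣ f f-inj (λ i → ∈-triple (f zero) e₁ e₂ (triangle (f i) (i , refl))))
                 (∣triple∣≤3 (f zero) e₁ e₂)
  ...   | s≤s (s≤s (s≤s ()))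

  commonEnd⇒∣p∣≤degree : ∀ {I : Subset (n (coLine G))} x → (∀ {a} → a ∈ I → Incident G x a) →
                         ∣ I ∣ ≤ ∣ neighbourhood G x ∣
  commonEnd⇒∣p∣≤degree {I} x through-x = injectiveOn⇒∣p∣≤∣q∣ (otherEnd G x) into injective
    where
    into : ∀ {a} → a ∈ I → otherEnd G x a ∈ neighbourhood G x
    into a∈I = ∈-neighbourhood⁺ G (proj₁ (otherEnd-spec G x _ (through-x a∈I)))
    injective : ∀ {a b} → a ∈ I → b ∈ I → otherEnd G x a ≡ otherEnd G x b → a ≡ b
    injective {a} {b} a∈I b∈I e with otherEnd-spec G x a (through-x a∈I) | otherEnd-spec G x b (through-x b∈I)
    ... | _ , other≢x , other∈a | _ , _ , other∈b =
      two-incident⇒≡ G (other≢x ∘ sym) (through-x a∈I) other∈a (through-x b∈I) (subst (λ v → Incident G v b) (sym e) other∈b)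

  intersecting⇒∣p∣≤3+degree : ∀ {d} (I : Subset (n (coLine G))) → (∀ a b → a ∈ I → b ∈ I → Intersect G a b) →
                              (∀ x a → a ∈ I → Incident G x a → ∣ neighbourhood G x ∣ ≤ d) → ∣ I ∣ ≤ 3 + d
  intersecting⇒∣p∣≤3+degree {d} I intersecting degree≤ with ∣ I ∣ ℕ.≟ 0
  ... | yes ∣I∣≡0 = subst (_≤ 3 + d) (sym ∣I∣≡0) z≤n
  ... | no ∣I∣≢0 with ∣p∣>0⇒Nonempty I (n≢0⇒n>0 ∣I∣≢0)
  ...   | e₀ , e₀∈I with intersecting⇒commonEnd-or-three (_∈? I) intersecting e₀∈I
  ...     | inj₁ (x , through-x) =
    ≤-trans (commonEnd⇒∣p∣≤degree x (through-x _)) (≤-trans (degree≤ x e₀ e₀∈I (through-x e₀ e₀∈I)) (m≤n+m d 3))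
  ...     | inj₂ (e₁ , e₂ , triangle) =
    ≤-trans (p⊆q⇒∣p∣≤∣q∣ (λ {a} a∈I → ∈-triple e₀ e₁ e₂ (triangle a a∈I))) (≤-trans (∣triple∣≤3 e₀ e₁ e₂) (m≤m+n 3 d))

module _ (s : ℕ) where

  twoStars-ll : ∀ (a b : Fin (suc s)) → twoStars s (a ↑ˡ suc s) (b ↑ˡ suc s) ≡ star s a b
  twoStars-ll a b rewrite splitAt-↑ˡ (suc s) a (suc s) | splitAt-↑ˡ (suc s) b (suc s) = refl

  twoStars-rr : ∀ (a b : Fin (suc s)) → twoStars s (suc s ↑ʳ a) (suc s ↑ʳ b) ≡ star s a b
  twoStars-rr a b rewrite splitAt-↑ʳ (suc s) (suc s) a | splitAt-↑ʳ (suc s) (suc s) b = refl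

  twoStars-lr : ∀ (a b : Fin (suc s)) → twoStars s (a ↑ˡ suc s) (suc s ↑ʳ b) ≡ false
  twoStars-lr a b rewrite splitAt-↑ˡ (suc s) a (suc s) | splitAt-↑ʳ (suc s) (suc s) b = refl

  twoStars-rl : ∀ (a b : Fin (suc s)) → twoStars s (suc s ↑ʳ a) (b ↑ˡ suc s) ≡ false
  twoStars-rl a b rewrite splitAt-↑ʳ (suc s) (suc s) a | splitAt-↑ˡ (suc s) b (suc s) = refl

[_,_]-↑ˡ : ∀ {A : Set} {m k} (f : Fin m → A) (g : Fin k → A) i → [ f , g ]′ (splitAt m (i ↑ˡ k)) ≡ f i
[_,_]-↑ˡ {m = m} {k} f g i rewrite splitAt-↑ˡ m i k = refl

[_,_]-↑ʳ : ∀ {A : Set} {m k} (f : Fin m → A) (g : Fin k → A) j → [ f , g ]′ (splitAt m (m ↑ʳ j)) ≡ g j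
[_,_]-↑ʳ {m = m} {k} f g j rewrite splitAt-↑ʳ m k j = refl

record TwoStars (G : Graph) (s : ℕ) : Set where
  field
    centreA centreB : V G
    leavesA leavesB : Fin s → V G
    injectiveA : Injective _≡_ _≡_ (starVertex centreA leavesA)
    injectiveB : Injective _≡_ _≡_ (starVertex centreB leavesB)
    disjoint   : ∀ a b → starVertex centreA leavesA a ≢ starVertex centreB leavesB b
    adjacentA  : ∀ k → adj G centreA (leavesA k) ≡ true
    adjacentB  : ∀ k → adj G centreB (leavesB k) ≡ true

module _ {G : Graph} {s : ℕ} where

  TwoStars⇒copy : TwoStars G s → SubgraphCopy (twoStars s) (adj G)
  TwoStars⇒copy stars = g , g-inj , g-edge
    where
    open TwoStars stars
    starA starB : Fin (suc s) → V G
    starA = starVertex centreA leavesA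
    starB = starVertex centreB leavesB
    g : Fin (suc s + suc s) → V G
    g i = [ starA , starB ]′ (splitAt (suc s) i)
    g-inj : Injective _≡_ _≡_ g
    g-inj {i} {j} e with view (suc s) (suc s) i | view (suc s) (suc s) j
    ... | left a | left b = cong (_↑ˡ suc s) (injectiveA (trans (sym ([ starA , starB ]-↑ˡ a)) (trans e ([ starA , starB ]-↑ˡ b))))
    ... | right a | right b = cong (suc s ↑ʳ_) (injectiveB (trans (sym ([ starA , starB ]-↑ʳ a)) (trans e ([ starA , starB ]-↑ʳ b))))
    ... | left a | right b = contradiction (trans (sym ([ starA , starB ]-↑ˡ a)) (trans e ([ starA , starB ]-↑ʳ b))) (disjoint a b)
    ... | right a | left b = contradiction (trans (sym ([ starA , starB ]-↑ˡ b)) (trans (sym e) ([ starA , starB ]-↑ʳ a))) (disjoint b a)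
    star-edge : ∀ {c} {l : Fin s → V G} → (∀ k → adj G c (l k) ≡ true) →
                ∀ a b → star s a b ≡ true → adj G (starVertex c l a) (starVertex c l b) ≡ true
    star-edge c~l zero (suc b) _ = c~l b
    star-edge c~l (suc a) zero _ = trans (adj-sym G _ _) (c~l a)
    g-edge : ∀ i j → twoStars s i j ≡ true → adj G (g i) (g j) ≡ true
    g-edge i j h with view (suc s) (suc s) i | view (suc s) (suc s) j
    ... | left a | left b rewrite [ starA , starB ]-↑ˡ a | [ starA , starB ]-↑ˡ b =
      star-edge adjacentA a b (trans (sym (twoStars-ll s a b)) h)
    ... | right a | right b rewrite [ starA , starB ]-↑ʳ a | [ starA , starB ]-↑ʳ b =
      star-edge adjacentB a b (trans (sym (twoStars-rr s a b)) h)
    ... | left a | right b = contradiction (trans (sym h) (twoStars-lr s a b)) λ ()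
    ... | right a | left b = contradiction (trans (sym h) (twoStars-rl s a b)) λ ()

  copy⇒TwoStars : SubgraphCopy (twoStars s) (adj G) → TwoStars G s
  copy⇒TwoStars (g , g-inj , g-edge) = record
    { centreA = starA zero
    ; centreB = starB zero
    ; leavesA = starA ∘ suc
    ; leavesB = starB ∘ suc
    ; injectiveA = λ {a} {b} e → ↑ˡ-injective (suc s) a b (g-inj (trans (sym (as-starA a)) (trans e (as-starA b))))
    ; injectiveB = λ {a} {b} e → ↑ʳ-injective (suc s) a b (g-inj (trans (sym (as-starB a)) (trans e (as-starB b))))
    ; disjoint = λ a b e → ↑ˡ≢↑ʳ (suc s) (suc s) a b (g-inj (trans (sym (as-starA a)) (trans e (as-starB b))))
    ; adjacentA = λ k → g-edge _ _ (twoStars-ll s zero (suc k))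
    ; adjacentB = λ k → g-edge _ _ (twoStars-rr s zero (suc k))
    }
    where
    starA starB : Fin (suc s) → V G
    starA a = g (a ↑ˡ suc s)
    starB b = g (suc s ↑ʳ b)
    as-starA : ∀ a → starVertex (starA zero) (starA ∘ suc) a ≡ starA a
    as-starA zero = refl
    as-starA (suc a) = refl
    as-starB : ∀ b → starVertex (starB zero) (starB ∘ suc) b ≡ starB b
    as-starB zero = refl
    as-starB (suc b) = refl

module StarEdges (G : Graph) {s : ℕ} (c : V G) (l : Fin s → V G)
                 (injective : Injective _≡_ _≡_ (starVertex c l)) (adjacent : ∀ k → adj G c (l k) ≡ true) where

  edge : Fin s → E G
  edge k = proj₁ (edgeBetween G c (l k) (adjacent k))

  centre∈edge : ∀ k → Incident G c (edge k)
  centre∈edge k = proj₁ (proj₂ (edgeBetween G c (l k) (adjacent k)))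

  leaf∈edge : ∀ k → Incident G (l k) (edge k)
  leaf∈edge k = proj₂ (proj₂ (edgeBetween G c (l k) (adjacent k)))

  centre≢leaf : ∀ k → c ≢ l k
  centre≢leaf k e = contradiction (injective {zero} {suc k} e) λ ()

  ends-in-star : ∀ k v → Incident G v (edge k) → ∃ λ a → v ≡ starVertex c l a
  ends-in-star k v v∈ with only-two-ends G (centre∈edge k) (leaf∈edge k) (centre≢leaf k) v v∈
  ... | inj₁ v≡c = zero , v≡c
  ... | inj₂ v≡l = suc k , v≡l

  edge-injective : Injective _≡_ _≡_ edge
  edge-injective {k} {k′} e with only-two-ends G (centre∈edge k′) (leaf∈edge k′) (centre≢leaf k′) (l k)
                                   (subst (Incident G (l k)) e (leaf∈edge k))
  ... | inj₁ l≡c = contradiction (sym l≡c) (centre≢leaf k)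
  ... | inj₂ l≡l = suc-injective (injective l≡l)

TwoStars⇒Kss-copy : ∀ {G s} → TwoStars G s → InducedCopy (Kss s) (adj (coLine G))
TwoStars⇒Kss-copy {G} {s} stars = F , F-inj , F-adj
  where
  open TwoStars stars
  module A = StarEdges G centreA leavesA injectiveA adjacentA
  module B = StarEdges G centreB leavesB injectiveB adjacentB
  F : Fin (s + s) → E G
  F i = [ A.edge , B.edge ]′ (splitAt s i)
  A-B-disjoint : ∀ k k′ → ¬ Intersect G (A.edge k) (B.edge k′)
  A-B-disjoint k k′ (v , v∈A , v∈B) with A.ends-in-star k v v∈A | B.ends-in-star k′ v v∈B
  ... | a , v≡a | b , v≡b = disjoint a b (trans (sym v≡a) v≡b)
  F-adj : ∀ i j → adj (coLine G) (F i) (F j) ≡ Kss s i j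
  F-adj i j with view s s i | view s s j
  ... | left k | left k′ rewrite [ A.edge , B.edge ]-↑ˡ k | [ A.edge , B.edge ]-↑ˡ k′ | Kss-ll s k k′ =
    Intersect⇒coLine-nonadjacent G _ _ (centreA , A.centre∈edge k , A.centre∈edge k′)
  ... | right k | right k′ rewrite [ A.edge , B.edge ]-↑ʳ k | [ A.edge , B.edge ]-↑ʳ k′ | Kss-rr s k k′ =
    Intersect⇒coLine-nonadjacent G _ _ (centreB , B.centre∈edge k , B.centre∈edge k′)
  ... | left k | right k′ rewrite [ A.edge , B.edge ]-↑ˡ k | [ A.edge , B.edge ]-↑ʳ k′ | Kss-lr s k k′ =
    disjoint⇒coLine-adjacent G _ _ (A-B-disjoint k k′)
  ... | right k | left k′ rewrite [ A.edge , B.edge ]-↑ʳ k | [ A.edge , B.edge ]-↑ˡ k′ | Kss-rl s k k′ =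
    disjoint⇒coLine-adjacent G _ _ (A-B-disjoint k′ k ∘ Intersect-sym G)
  F-inj : Injective _≡_ _≡_ F
  F-inj {i} {j} e with view s s i | view s s j
  ... | left k | left k′ =
    cong (_↑ˡ s) (A.edge-injective (trans (sym ([ A.edge , B.edge ]-↑ˡ k)) (trans e ([ A.edge , B.edge ]-↑ˡ k′))))
  ... | right k | right k′ =
    cong (s ↑ʳ_) (B.edge-injective (trans (sym ([ A.edge , B.edge ]-↑ʳ k)) (trans e ([ A.edge , B.edge ]-↑ʳ k′))))
  ... | left k | right k′ = contradiction e (adjacent⇒≢ (adj (coLine G)) (adj-irrefl (coLine G)) (trans (F-adj _ _) (Kss-lr s k k′)))
  ... | right k | left k′ = contradiction e (adjacent⇒≢ (adj (coLine G)) (adj-irrefl (coLine G)) (trans (F-adj _ _) (Kss-rl s k k′)))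

module IntersectingStar (G : Graph) {s : ℕ} (f : Fin (4 + s) → E G) (f-inj : Injective _≡_ _≡_ f)
                        (intersecting : ∀ i j → Intersect G (f i) (f j)) where

  centre : V G
  centre = proj₁ (large-intersecting⇒commonEnd G f f-inj intersecting)

  centre∈ : ∀ i → Incident G centre (f i)
  centre∈ = proj₂ (large-intersecting⇒commonEnd G f f-inj intersecting)

  -- the first four edges only serve to force a common end
  leaf : Fin s → V G
  leaf k = otherEnd G centre (f (4 ↑ʳ k))

  private
    leaf-spec : ∀ k → adj G centre (leaf k) ≡ true × leaf k ≢ centre × Incident G (leaf k) (f (4 ↑ʳ k))
    leaf-spec k = otherEnd-spec G centre (f (4 ↑ʳ k)) (centre∈ (4 ↑ʳ k))

  adjacent : ∀ k → adj G centre (leaf k) ≡ true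
  adjacent = proj₁ ∘ leaf-spec

  injective : Injective _≡_ _≡_ (starVertex centre leaf)
  injective = starVertex-injective leaf-injective (proj₁ ∘ proj₂ ∘ leaf-spec)
    where
    leaf-injective : Injective _≡_ _≡_ leaf
    leaf-injective {k} {k′} e = ↑ʳ-injective 4 k k′ (f-inj
      (two-incident⇒≡ G (proj₁ (proj₂ (leaf-spec k)) ∘ sym) (centre∈ _) (proj₂ (proj₂ (leaf-spec k)))
                        (centre∈ _) (subst (λ v → Incident G v (f (4 ↑ʳ k′))) (sym e) (proj₂ (proj₂ (leaf-spec k′))))))

  on-some-edge : ∀ a → ∃ λ i → Incident G (starVertex centre leaf a) (f i)
  on-some-edge zero = zero , centre∈ zero
  on-some-edge (suc k) = 4 ↑ʳ k , proj₂ (proj₂ (leaf-spec k))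

Kss-copy⇒TwoStars : ∀ {G s} → InducedCopy (Kss (4 + s)) (adj (coLine G)) → TwoStars G s
Kss-copy⇒TwoStars {G} {s} (φ , φ-inj , φ-adj) = record
  { centreA = A.centre ; centreB = B.centre ; leavesA = A.leaf ; leavesB = B.leaf
  ; injectiveA = A.injective ; injectiveB = B.injective
  ; disjoint = disjoint
  ; adjacentA = A.adjacent ; adjacentB = B.adjacent
  }
  where
  S : ℕ
  S = 4 + s
  module A = IntersectingStar G (λ i → φ (i ↑ˡ S)) (λ e → ↑ˡ-injective S _ _ (φ-inj e))
    (λ i j → coLine-nonadjacent⇒Intersect G (φ (i ↑ˡ S)) (φ (j ↑ˡ S)) (trans (φ-adj (i ↑ˡ S) (j ↑ˡ S)) (Kss-ll S i j)))
  module B = IntersectingStar G (λ j → φ (S ↑ʳ j)) (λ e → ↑ʳ-injective S _ _ (φ-inj e))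
    (λ i j → coLine-nonadjacent⇒Intersect G (φ (S ↑ʳ i)) (φ (S ↑ʳ j)) (trans (φ-adj (S ↑ʳ i) (S ↑ʳ j)) (Kss-rr S i j)))
  disjoint : ∀ a b → starVertex A.centre A.leaf a ≢ starVertex B.centre B.leaf b
  disjoint a b e = coLine-adjacent⇒disjoint G (φ (i ↑ˡ S)) (φ (S ↑ʳ j)) (trans (φ-adj (i ↑ˡ S) (S ↑ʳ j)) (Kss-lr S i j))
                      (starVertex A.centre A.leaf a , a∈ , subst (λ v → Incident G v (φ (S ↑ʳ j))) (sym e) b∈)
    where
    i j : Fin S
    i = proj₁ (A.on-some-edge a)
    j = proj₁ (B.on-some-edge b)
    a∈ : Incident G (starVertex A.centre A.leaf a) (φ (i ↑ˡ S))
    a∈ = proj₂ (A.on-some-edge a)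
    b∈ : Incident G (starVertex B.centre B.leaf b) (φ (S ↑ʳ j))
    b∈ = proj₂ (B.on-some-edge b)

-- Graphs without 2K_{1,s}

module _ (G : Graph) (s : ℕ) where

  HighDegree : V G → Set
  HighDegree v = suc (s + s) ≤ ∣ neighbourhood G v ∣

  high⇒2s≤∣N-x∣ : ∀ {w} x → HighDegree w → s + s ≤ ∣ neighbourhood G w - x ∣
  high⇒2s≤∣N-x∣ {w} x high = ≤-pred (≤-trans high (∣p∣≤1+∣p-x∣ (neighbourhood G w) x))

  twoHighDegree⇒TwoStars : ∀ {u v} → u ≢ v → HighDegree u → HighDegree v → TwoStars G s
  twoHighDegree⇒TwoStars {u} {v} u≢v u-high v-high
    with distinctElements (neighbourhood G u - v) (≤-trans (m≤m+n s s) (high⇒2s≤∣N-x∣ v u-high))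
  ... | leavesA , leavesA-inj , leavesA∈
    with distinctElements (neighbourhood G v - u ─ image leavesA)
           (k+m≤∣p∣⇒m≤∣p─image∣ leavesA (neighbourhood G v - u) (high⇒2s≤∣N-x∣ u v-high))
  ... | leavesB , leavesB-inj , leavesB∈ = record
    { centreA = u ; centreB = v ; leavesA = leavesA ; leavesB = leavesB
    ; injectiveA = starVertex-injective leavesA-inj (λ k → adjacent⇒≢ (adj G) (adj-irrefl G) (adjacentA k) ∘ sym)
    ; injectiveB = starVertex-injective leavesB-inj (λ k → adjacent⇒≢ (adj G) (adj-irrefl G) (adjacentB k) ∘ sym)
    ; disjoint = disjoint
    ; adjacentA = adjacentA ; adjacentB = adjacentB
    }
    where
    leavesB∈N-u : ∀ k → leavesB k ∈ neighbourhood G v - u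
    leavesB∈N-u k = p─q⊆p _ (image leavesA) (leavesB∈ k)
    adjacentA : ∀ k → adj G u (leavesA k) ≡ true
    adjacentA k = ∈-neighbourhood⁻ G (p─q⊆p _ ⁅ v ⁆ (leavesA∈ k))
    adjacentB : ∀ k → adj G v (leavesB k) ≡ true
    adjacentB k = ∈-neighbourhood⁻ G (p─q⊆p _ ⁅ u ⁆ (leavesB∈N-u k))
    disjoint : ∀ a b → starVertex u leavesA a ≢ starVertex v leavesB b
    disjoint zero zero e = u≢v e
    disjoint zero (suc b) e = x∈p-y⇒x≢y (neighbourhood G v) (leavesB∈N-u b) (sym e)
    disjoint (suc a) zero e = x∈p-y⇒x≢y (neighbourhood G u) (leavesA∈ a) e
    disjoint (suc a) (suc b) e =
      x∈p─q⇒x∉q (neighbourhood G v - u) (image leavesA) (leavesB∈ b) (subst (_∈ image leavesA) e (∈-image leavesA a))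

  private
    independent⇒intersecting : ∀ {I} → Independent (coLine G) I → ∀ a b → a ∈ I → b ∈ I → Intersect G a b
    independent⇒intersecting indep a b a∈ b∈ = coLine-nonadjacent⇒Intersect G a b (indep a b a∈ b∈)

    low-degree : ∀ {x} → ¬ HighDegree x → ∣ neighbourhood G x ∣ ≤ s + s
    low-degree = ≤-pred ∘ ≰⇒>

  -- all edges if every degree is at most 2s; otherwise the edges missing a vertex h of larger degree
  twoStarFree⇒smallCover : TwoStarSubgraphFree G s →
    Σ (Subset (n (coLine G))) λ C → IsVertexCover (coLine G) C × AlphaAtMost (coLine G) C (3 + (s + s))
  twoStarFree⇒smallCover free with any? (λ v → suc (s + s) ≤? ∣ neighbourhood G v ∣)
  ... | no no-high = ⊤ , (λ _ _ _ → inj₁ ∈⊤) ,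
    λ I _ indep → intersecting⇒∣p∣≤3+degree G I (independent⇒intersecting indep) (λ x _ _ _ → low-degree (no-high ∘ (x ,_)))
  ... | yes (h , h-high) = C , cover , α≤
    where
    avoids-h? : Decidable (λ e → ¬ Incident G h e)
    avoids-h? e = ¬? (incident? G h e)
    C : Subset (n (coLine G))
    C = subset avoids-h?
    cover : IsVertexCover (coLine G) C
    cover a b a~b with incident? G h a
    ... | no h∉a = inj₁ (∈-subset⁺ avoids-h? h∉a)
    ... | yes h∈a = inj₂ (∈-subset⁺ avoids-h? (λ h∈b → coLine-adjacent⇒disjoint G a b a~b (h , h∈a , h∈b)))
    α≤ : AlphaAtMost (coLine G) C (3 + (s + s))
    α≤ I I⊆C indep = intersecting⇒∣p∣≤3+degree G I (independent⇒intersecting indep) degree≤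
      where
      degree≤ : ∀ x a → a ∈ I → Incident G x a → ∣ neighbourhood G x ∣ ≤ s + s
      degree≤ x a a∈I x∈a with suc (s + s) ≤? ∣ neighbourhood G x ∣
      ... | no x-low = low-degree x-low
      ... | yes x-high with x ≟ h
      ...   | yes refl = contradiction x∈a (∈-subset⁻ avoids-h? (I⊆C a∈I))
      ...   | no x≢h = contradiction (TwoStars⇒copy (twoHighDegree⇒TwoStars (x≢h ∘ sym) h-high x-high)) free

module _ (𝒢 : Class) where

  P1⇒P5 : P1 𝒢 → P5 𝒢
  P1⇒P5 (f , tw≤f) = s , s≤s z≤n , λ G G∈𝒢 stars →
    contradiction (Kss-copy⇒s≤treewidth+1 (completeBipartite s) (id , id , λ _ _ → refl)
                     (tw≤f G G∈𝒢 (completeBipartite s) (TwoStars⇒Kss-copy (copy⇒TwoStars {G} stars)) 2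
                           (completeBipartite-cliqueNumber (suc (f 2)))))
                  (<-irrefl refl)
    where
    s : ℕ
    s = suc (suc (f 2))

  P2⇒P5 : P2 𝒢 → P5 𝒢
  P2⇒P5 (c , treeα≤c) = suc c , s≤s z≤n , λ G G∈𝒢 stars →
    contradiction (Kss-copy⇒s≤treeAlpha (coLine G) (TwoStars⇒Kss-copy (copy⇒TwoStars {G} stars)) (treeα≤c G G∈𝒢))
                  (<-irrefl refl)

  P3⇒P5 : P3 𝒢 → P5 𝒢
  P3⇒P5 (s , 1≤s , Kss-free) = s , 1≤s , λ G G∈𝒢 → Kss-free G G∈𝒢 ∘ TwoStars⇒Kss-copy ∘ copy⇒TwoStars {G}

  P5⇒P3 : P5 𝒢 → P3 𝒢
  P5⇒P3 (s , _ , free) = 4 + s , s≤s z≤n , λ G G∈𝒢 → free G G∈𝒢 ∘ TwoStars⇒copy ∘ Kss-copy⇒TwoStars {G} {s}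

  P5⇒P4 : P5 𝒢 → P4 𝒢
  P5⇒P4 (s , _ , free) = 3 + (s + s) , s≤s z≤n , λ G G∈𝒢 → twoStarFree⇒smallCover G s (free G G∈𝒢)

  P4⇒P2 : P4 𝒢 → P2 𝒢
  P4⇒P2 (s , _ , cover) = suc s , λ G G∈𝒢 →
    let (C , C-cover , α≤s) = cover G G∈𝒢 in vertexCover⇒treeAlphaAtMost (coLine G) C-cover α≤s

  P4⇒P1 : P4 𝒢 → P1 𝒢
  P4⇒P1 (s , _ , cover) = (λ w → ramseyBound (suc w) (suc s)) , λ G G∈𝒢 →
    let (C , C-cover , α≤s) = cover G G∈𝒢 in vertexCover⇒inducedTreewidthAtMost (coLine G) C-cover α≤s

theorem1p7 : (𝒢 : Class) →
    (P1 𝒢 ⇔ P2 𝒢) × (P2 𝒢 ⇔ P3 𝒢) × (P3 𝒢 ⇔ P4 𝒢) × (P4 𝒢 ⇔ P5 𝒢)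
theorem1p7 𝒢 =
    mk⇔ (P4⇒P2 𝒢 ∘ P5⇒P4 𝒢 ∘ P1⇒P5 𝒢) (P4⇒P1 𝒢 ∘ P5⇒P4 𝒢 ∘ P2⇒P5 𝒢)
  , mk⇔ (P5⇒P3 𝒢 ∘ P2⇒P5 𝒢) (P4⇒P2 𝒢 ∘ P5⇒P4 𝒢 ∘ P3⇒P5 𝒢)
  , mk⇔ (P5⇒P4 𝒢 ∘ P3⇒P5 𝒢) (P5⇒P3 𝒢 ∘ P2⇒P5 𝒢 ∘ P4⇒P2 𝒢)
  , mk⇔ (P2⇒P5 𝒢 ∘ P4⇒P2 𝒢) (P5⇒P4 𝒢)
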